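{- For all integers $r,n\ge0$, let $C_n(r;s,q,Y)$ be the coefficient of $u^n$ in the expansion as a power series in $u$ of $$C(r;u,s,q,Y)=\frac{(1-qs)\,(u;q)_r\,(usq;q)_r}{\bigl((u;q)_r-sq\,(usq;q)_r\bigr)\,(uY;q)_{r+1}}.$$ Then $$C_n(r;s,q,Y)=\sum_{w\in W_n(r)}s^{\mathrm{wlec}\,w}\,q^{\mathrm{tot}\,w}\,Y^{\mathrm{wpix}\,w}.$$
   Context: $(a;q)_0=1$, $(a;q)_n=(1-a)\cdots(1-aq^{n-1})$. $W_n(r)=\{0,\dots,r\}^n$; $\mathrm{tot}\,w$ is the sum of the letters. An $H$-word is a word $x_1\cdots x_k$ with $k\ge2$, $x_1<x_2$ and either $k=2$ or $x_2\ge\cdots\ge x_k$. Every word $w$ factors uniquely as $u\,h_1\cdots h_k$ with $u$ nonincreasing (possibly empty) and each $h_i$ an $H$-word; $\mathrm{wpix}\,w$ is the length of $u$ and $\mathrm{wlec}\,w=\sum_i\mathrm{inv}(\text{reverse of }h_i)$, where $\mathrm{inv}$ counts pairs of positions $a<b$ with $x_a>x_b$. -}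

module Defs where

open import Data.Nat as ℕ using (ℕ; zero; suc; _∸_; _<ᵇ_; _≤ᵇ_; _≡ᵇ_)
open import Data.Integer as ℤ using (ℤ; +_; 0ℤ; 1ℤ)
open import Data.List using (List; []; _∷_; map; concatMap; reverse; length; upTo)
open import Data.Nat.ListAction using (sum)
open import Data.Bool using (Bool; true; false; _∧_; if_then_else_)
open import Data.Product using (_×_; _,_)
open import Relation.Binary.PropositionalEquality using (_≡_)

-- Formal power series in four variables u, s, q, Y with integer
-- coefficients:  f a b c d  is the coefficient of  u^a s^b q^c Y^d.
-- (This ring Z[[u,s,q,Y]] contains Z[s,q,Y][[u]].)

Ser : Set
Ser = ℕ → ℕ → ℕ → ℕ → ℤ

_≈ₛ_ : Ser → Ser → Set
f ≈ₛ g = ∀ a b c d → f a b c d ≡ g a b c d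

Σ≤ : ℕ → (ℕ → ℤ) → ℤ
Σ≤ zero    f = f 0
Σ≤ (suc n) f = Σ≤ n f ℤ.+ f (suc n)

_+ₛ_ : Ser → Ser → Ser
(f +ₛ g) a b c d = f a b c d ℤ.+ g a b c d

_-ₛ_ : Ser → Ser → Ser
(f -ₛ g) a b c d = f a b c d ℤ.- g a b c d

_*ₛ_ : Ser → Ser → Ser
(f *ₛ g) a b c d =
  Σ≤ a λ i → Σ≤ b λ j → Σ≤ c λ k → Σ≤ d λ l →
    f i j k l ℤ.* g (a ∸ i) (b ∸ j) (c ∸ k) (d ∸ l)

mono : ℕ → ℕ → ℕ → ℕ → Ser
mono a b c d a' b' c' d' =
  if (a ≡ᵇ a') ∧ (b ≡ᵇ b') ∧ (c ≡ᵇ c') ∧ (d ≡ᵇ d') then 1ℤ else 0ℤ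

oneₛ : Ser
oneₛ = mono 0 0 0 0

poch : Ser → ℕ → Ser
poch x zero    = oneₛ
poch x (suc n) = poch x n *ₛ (oneₛ -ₛ (x *ₛ mono 0 0 n 0))

U USQ SQ UY : Ser
U   = mono 1 0 0 0
USQ = mono 1 1 1 0
SQ  = mono 0 1 1 0
UY  = mono 1 0 0 1

Num : ℕ → Ser
Num r = ((oneₛ -ₛ SQ) *ₛ poch U r) *ₛ poch USQ r

Den : ℕ → Ser
Den r = (poch U r -ₛ (SQ *ₛ poch USQ r)) *ₛ poch UY (suc r)

words : ℕ → ℕ → List (List ℕ)
words r zero    = [] ∷ []
words r (suc n) = concatMap (λ x → map (x ∷_) (words r n)) (upTo (suc r))

tot : List ℕ → ℕ
tot = sum

countBelow : ℕ → List ℕ → ℕ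
countBelow x []       = 0
countBelow x (y ∷ ys) = (if y <ᵇ x then 1 else 0) ℕ.+ countBelow x ys

inv : List ℕ → ℕ
inv []       = 0
inv (x ∷ xs) = countBelow x xs ℕ.+ inv xs

noninc : List ℕ → Bool
noninc []           = true
noninc (x ∷ [])     = true
noninc (x ∷ y ∷ xs) = (y ≤ᵇ x) ∧ noninc (y ∷ xs)

-- H-words: x1 ... xk, k ≥ 2, x1 < x2 and (k = 2 or x2 ≥ ... ≥ xk);
-- the case k = 2 is the case where the tail x2 is trivially nonincreasing.
isH : List ℕ → Bool
isH (x₁ ∷ x₂ ∷ xs) = (x₁ <ᵇ x₂) ∧ noninc (x₂ ∷ xs)
isH _              = false

allH : List (List ℕ) → Bool
allH []       = true
allH (h ∷ hs) = isH h ∧ allH hs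

prependBlock : ℕ → List (List ℕ) → List (List (List ℕ))
prependBlock x []       = ((x ∷ []) ∷ []) ∷ []
prependBlock x (b ∷ bs) = ((x ∷ []) ∷ b ∷ bs) ∷ ((x ∷ b) ∷ bs) ∷ []

compositions : List ℕ → List (List (List ℕ))
compositions []       = [] ∷ []
compositions (x ∷ xs) = concatMap (prependBlock x) (compositions xs)

splits : List ℕ → List (List ℕ × List ℕ)
splits []       = ([] , []) ∷ []
splits (x ∷ xs) = ([] , x ∷ xs) ∷ map (λ { (p , s) → (x ∷ p , s) }) (splits xs)

candidates : List ℕ → List (List ℕ × List (List ℕ))
candidates w = concatMap (λ { (u , v) → map (u ,_) (compositions v) }) (splits w)

isFactorization : List ℕ × List (List ℕ) → Bool
isFactorization (u , hs) = noninc u ∧ allH hs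

wpixF : List ℕ × List (List ℕ) → ℕ
wpixF (u , hs) = length u

wlecF : List ℕ × List (List ℕ) → ℕ
wlecF (u , hs) = sum (map (λ h → inv (reverse h)) hs)

-- Coefficient of u^n s^b q^c Y^d: number of pairs (w , F) with w ∈ W_n(r),
-- F a factorization of w as in the paper (unique by the paper's remark),
-- wlec = b, tot w = c, wpix = d.

indicator : Bool → ℕ
indicator true  = 1
indicator false = 0

countFact : ℕ → ℕ → ℕ → List ℕ → ℕ
countFact b c d w =
  sum (map (λ F → indicator (isFactorization F ∧ (wlecF F ≡ᵇ b)
                             ∧ (tot w ≡ᵇ c) ∧ (wpixF F ≡ᵇ d)))
           (candidates w))

WordSer : ℕ → Ser
WordSer r n b c d = + sum (map (countFact b c d) (words r n))

-- Read from right to left, a word determines its factorization u h₁ ⋯ hₖ letter by letter: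
-- a new first letter y either extends the nonincreasing prefix u or, when u starts above y,
-- turns y u into an H-word whose reversal has as many inversions as u has letters above y.
-- So the generating series G(x) of the words whose prefix starts below x, with the letters
-- of u weighted by monomials c_m, satisfy first-letter recurrences which amount to
-- Π_{m<x} (1 - u c_m) G(x) = E, where E counts the words with empty prefix. For
-- c_m = Y q^m this gives (uY;q)_{r+1} · (series of the statement) = E. Marking the prefix
-- letters ≥ t by s and telescoping over t gives ((u;q)_r - sq (usq;q)_r) E = (1 - sq) (u;q)_r (usq;q)_r.
-- Everything takes place in Z[[u,s,q,Y]], where the factors 1 - u c may be cancelled.

module Submission where

open import Defs
open import Data.Nat using (ℕ)

open import Level using (0ℓ)
open import Algebra.Bundles using (CommutativeRing)
open import Algebra.Structures using (IsCommutativeRing)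
import Algebra.Properties.CommutativeSemigroup as CommSemigroupProperties
open import Data.Nat as ℕ using (zero; suc; _∸_; _≤_; _<_; _≡ᵇ_; _≤ᵇ_; _<ᵇ_; z≤n; s≤s)
import Data.Nat.Properties as ℕ
open import Data.Integer as ℤ using (ℤ; 0ℤ; 1ℤ)
import Data.Integer.Properties as ℤ
open import Data.Bool using (Bool; true; false; if_then_else_; _∧_; not; T)
open import Data.Product using (_×_; _,_; proj₁; proj₂; map₁)
open import Data.List using (List; []; _∷_; map; concatMap; reverse; length; upTo; _++_)
import Data.List.Properties as List
open import Data.Maybe using (Maybe; just; nothing)
open import Data.Nat.ListAction using (sum)
import Data.Nat.ListAction.Properties as ℕ
open import Data.Empty using (⊥; ⊥-elim)
open import Data.Sum using (inj₁; inj₂)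
open import Relation.Binary.Definitions using (tri<; tri≈; tri>)
open import Relation.Binary.PropositionalEquality as ≡ using (_≡_)

-- Formal power series in one variable

module FormalPowerSeries (R : CommutativeRing 0ℓ 0ℓ) where

  open CommutativeRing R
  open import Relation.Binary.Reasoning.Setoid setoid
  open CommSemigroupProperties +-commutativeSemigroup using (interchange)

  Series : Set
  Series = ℕ → Carrier

  sum≤ : ℕ → (ℕ → Carrier) → Carrier
  sum≤ zero    f = f 0
  sum≤ (suc n) f = sum≤ n f + f (suc n)

  infix  4 _≈ᴾ_
  infixl 6 _+ᴾ_
  infixl 7 _*ᴾ_

  _≈ᴾ_ : Series → Series → Set
  f ≈ᴾ g = ∀ n → f n ≈ g n

  _+ᴾ_ : Series → Series → Series
  (f +ᴾ g) n = f n + g n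

  _*ᴾ_ : Series → Series → Series
  (f *ᴾ g) n = sum≤ n λ i → f i * g (n ∸ i)

  -ᴾ_ : Series → Series
  (-ᴾ f) n = - f n

  0ᴾ : Series
  0ᴾ _ = 0#

  1ᴾ : Series
  1ᴾ zero    = 1#
  1ᴾ (suc _) = 0#

  monomial : ℕ → Carrier → Series
  monomial k c n = if k ≡ᵇ n then c else 0#

  sum≤-cong : ∀ n {f g : ℕ → Carrier} → (∀ i → f i ≈ g i) → sum≤ n f ≈ sum≤ n g
  sum≤-cong zero    f≈g = f≈g 0
  sum≤-cong (suc n) f≈g = +-cong (sum≤-cong n f≈g) (f≈g (suc n))

  sum≤-cong-≤ : ∀ n {f g : ℕ → Carrier} → (∀ i → i ≤ n → f i ≈ g i) → sum≤ n f ≈ sum≤ n g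
  sum≤-cong-≤ zero    f≈g = f≈g 0 z≤n
  sum≤-cong-≤ (suc n) f≈g =
    +-cong (sum≤-cong-≤ n λ i i≤n → f≈g i (ℕ.m≤n⇒m≤1+n i≤n)) (f≈g (suc n) ℕ.≤-refl)

  sum≤-suc : ∀ n f → sum≤ (suc n) f ≈ f 0 + sum≤ n (λ i → f (suc i))
  sum≤-suc zero    f = refl
  sum≤-suc (suc n) f = trans (+-congʳ (sum≤-suc n f)) (+-assoc _ _ _)

  sum≤-+ : ∀ n f g → sum≤ n (λ i → f i + g i) ≈ sum≤ n f + sum≤ n g
  sum≤-+ zero    f g = refl
  sum≤-+ (suc n) f g = trans (+-congʳ (sum≤-+ n f g)) (interchange _ _ _ _)

  *-distribˡ-sum≤ : ∀ n c f → c * sum≤ n f ≈ sum≤ n (λ i → c * f i)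
  *-distribˡ-sum≤ zero    c f = refl
  *-distribˡ-sum≤ (suc n) c f = trans (distribˡ c _ _) (+-congʳ (*-distribˡ-sum≤ n c f))

  *-distribʳ-sum≤ : ∀ n c f → sum≤ n f * c ≈ sum≤ n (λ i → f i * c)
  *-distribʳ-sum≤ zero    c f = refl
  *-distribʳ-sum≤ (suc n) c f = trans (distribʳ c _ _) (+-congʳ (*-distribʳ-sum≤ n c f))

  sum≤-zero : ∀ n f → (∀ i → f i ≈ 0#) → sum≤ n f ≈ 0#
  sum≤-zero zero    f f≈0 = f≈0 0
  sum≤-zero (suc n) f f≈0 = trans (+-cong (sum≤-zero n f f≈0) (f≈0 (suc n))) (+-identityˡ 0#)

  sum≤-reverse : ∀ n f → sum≤ n f ≈ sum≤ n (λ i → f (n ∸ i))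
  sum≤-reverse zero    f = refl
  sum≤-reverse (suc n) f = begin
    sum≤ n f + f (suc n)                      ≈⟨ +-comm _ _ ⟩
    f (suc n) + sum≤ n f                      ≈⟨ +-congˡ (sum≤-reverse n f) ⟩
    f (suc n) + sum≤ n (λ i → f (n ∸ i))      ≈⟨ sum≤-suc n (λ i → f (suc n ∸ i)) ⟨
    sum≤ (suc n) (λ i → f (suc n ∸ i))        ∎

  sum≤-triangle : ∀ n (F : ℕ → ℕ → Carrier) →
    sum≤ n (λ i → sum≤ (n ∸ i) (F i)) ≈ sum≤ n (λ m → sum≤ m (λ i → F i (m ∸ i)))
  sum≤-triangle zero    F = refl
  sum≤-triangle (suc n) F = begin
    sum≤ (suc n) (λ i → sum≤ (suc n ∸ i) (F i))
      ≈⟨ sum≤-suc n _ ⟩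
    sum≤ (suc n) (F 0) + sum≤ n (λ i → sum≤ (n ∸ i) (F (suc i)))
      ≈⟨ +-cong (sum≤-suc n (F 0)) (sum≤-triangle n (λ i → F (suc i))) ⟩
    (F 0 0 + sum≤ n (λ m → F 0 (suc m))) + sum≤ n (λ m → sum≤ m (λ i → F (suc i) (m ∸ i)))
      ≈⟨ +-assoc _ _ _ ⟩
    F 0 0 + (sum≤ n (λ m → F 0 (suc m)) + sum≤ n (λ m → sum≤ m (λ i → F (suc i) (m ∸ i))))
      ≈⟨ +-congˡ (sum≤-+ n _ _) ⟨
    F 0 0 + sum≤ n (λ m → F 0 (suc m) + sum≤ m (λ i → F (suc i) (m ∸ i)))
      ≈⟨ +-congˡ (sum≤-cong n λ m → sum≤-suc m (λ i → F i (suc m ∸ i))) ⟨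
    F 0 0 + sum≤ n (λ m → sum≤ (suc m) (λ i → F i (suc m ∸ i)))
      ≈⟨ sum≤-suc n _ ⟨
    sum≤ (suc n) (λ m → sum≤ m (λ i → F i (m ∸ i)))
      ∎

  *ᴾ-cong : ∀ {f f′ g g′} → f ≈ᴾ f′ → g ≈ᴾ g′ → f *ᴾ g ≈ᴾ f′ *ᴾ g′
  *ᴾ-cong f≈ g≈ n = sum≤-cong n λ i → *-cong (f≈ i) (g≈ (n ∸ i))

  *ᴾ-congˡ : ∀ f {g g′} → g ≈ᴾ g′ → f *ᴾ g ≈ᴾ f *ᴾ g′
  *ᴾ-congˡ f g≈ n = sum≤-cong n λ i → *-congˡ (g≈ (n ∸ i))

  *ᴾ-congʳ : ∀ {f f′} g → f ≈ᴾ f′ → f *ᴾ g ≈ᴾ f′ *ᴾ g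
  *ᴾ-congʳ g f≈ n = sum≤-cong n λ i → *-congʳ (f≈ i)

  *ᴾ-comm : ∀ f g → f *ᴾ g ≈ᴾ g *ᴾ f
  *ᴾ-comm f g n = begin
    sum≤ n (λ i → f i * g (n ∸ i))              ≈⟨ sum≤-reverse n _ ⟩
    sum≤ n (λ i → f (n ∸ i) * g (n ∸ (n ∸ i)))  ≈⟨ sum≤-cong-≤ n (λ i i≤n →
      trans (*-comm _ _) (*-congʳ (reflexive (≡.cong g (ℕ.m∸[m∸n]≡n i≤n))))) ⟩
    sum≤ n (λ i → g i * f (n ∸ i))              ∎

  *ᴾ-assoc : ∀ f g h → (f *ᴾ g) *ᴾ h ≈ᴾ f *ᴾ (g *ᴾ h)
  *ᴾ-assoc f g h n = begin
    sum≤ n (λ m → sum≤ m (λ i → f i * g (m ∸ i)) * h (n ∸ m))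
      ≈⟨ sum≤-cong n (λ m → *-distribʳ-sum≤ m _ _) ⟩
    sum≤ n (λ m → sum≤ m (λ i → (f i * g (m ∸ i)) * h (n ∸ m)))
      ≈⟨ sum≤-cong-≤ n (λ m m≤n → sum≤-cong-≤ m λ i i≤m →
           trans (*-assoc _ _ _) (*-congˡ (*-congˡ (reflexive (≡.cong h (∸-split m≤n i≤m)))))) ⟩
    sum≤ n (λ m → sum≤ m (λ i → f i * (g (m ∸ i) * h (n ∸ i ∸ (m ∸ i)))))
      ≈⟨ sum≤-triangle n (λ i j → f i * (g j * h (n ∸ i ∸ j))) ⟨
    sum≤ n (λ i → sum≤ (n ∸ i) (λ j → f i * (g j * h (n ∸ i ∸ j))))
      ≈⟨ sum≤-cong n (λ i → *-distribˡ-sum≤ (n ∸ i) _ _) ⟨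
    sum≤ n (λ i → f i * sum≤ (n ∸ i) (λ j → g j * h (n ∸ i ∸ j)))
      ∎
    where
    ∸-split : ∀ {m n i} → m ≤ n → i ≤ m → n ∸ m ≡ n ∸ i ∸ (m ∸ i)
    ∸-split {m} {n} {i} m≤n i≤m =
      ≡.trans (≡.cong (n ∸_) (≡.sym (ℕ.m+[n∸m]≡n i≤m))) (≡.sym (ℕ.∸-+-assoc n i (m ∸ i)))

  *ᴾ-identityˡ : ∀ f → 1ᴾ *ᴾ f ≈ᴾ f
  *ᴾ-identityˡ f zero    = *-identityˡ (f 0)
  *ᴾ-identityˡ f (suc n) = begin
    sum≤ (suc n) (λ i → 1ᴾ i * f (suc n ∸ i))      ≈⟨ sum≤-suc n _ ⟩
    1# * f (suc n) + sum≤ n (λ i → 0# * f (n ∸ i)) ≈⟨ +-cong (*-identityˡ _) (sum≤-zero n _ λ i → zeroˡ _) ⟩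
    f (suc n) + 0#                                 ≈⟨ +-identityʳ _ ⟩
    f (suc n)                                      ∎

  *ᴾ-distribˡ : ∀ f g h → f *ᴾ (g +ᴾ h) ≈ᴾ f *ᴾ g +ᴾ f *ᴾ h
  *ᴾ-distribˡ f g h n = trans (sum≤-cong n λ i → distribˡ (f i) _ _) (sum≤-+ n _ _)

  *ᴾ-distribʳ : ∀ f g h → (g +ᴾ h) *ᴾ f ≈ᴾ g *ᴾ f +ᴾ h *ᴾ f
  *ᴾ-distribʳ f g h n = trans (sum≤-cong n λ i → distribʳ (f (n ∸ i)) _ _) (sum≤-+ n _ _)

  commutativeRing : CommutativeRing 0ℓ 0ℓ
  commutativeRing = record
    { Carrier = Series
    ; _≈_ = _≈ᴾ_
    ; _+_ = _+ᴾ_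
    ; _*_ = _*ᴾ_
    ; -_ = -ᴾ_
    ; 0# = 0ᴾ
    ; 1# = 1ᴾ
    ; isCommutativeRing = record
      { isRing = record
        { +-isAbelianGroup = record
          { isGroup = record
            { isMonoid = record
              { isSemigroup = record
                { isMagma = record
                  { isEquivalence = record
                    { refl = λ n → refl ; sym = λ e n → sym (e n) ; trans = λ e e′ n → trans (e n) (e′ n) }
                  ; ∙-cong = λ e e′ n → +-cong (e n) (e′ n) }
                ; assoc = λ f g h n → +-assoc _ _ _ }
              ; identity = (λ f n → +-identityˡ _) , (λ f n → +-identityʳ _) }
            ; inverse = (λ f n → -‿inverseˡ _) , (λ f n → -‿inverseʳ _)
            ; ⁻¹-cong = λ e n → -‿cong (e n) }
          ; comm = λ f g n → +-comm _ _ }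
        ; *-cong = *ᴾ-cong
        ; *-assoc = *ᴾ-assoc
        ; *-identity = *ᴾ-identityˡ , λ f n → trans (*ᴾ-comm f 1ᴾ n) (*ᴾ-identityˡ f n)
        ; distrib = *ᴾ-distribˡ , *ᴾ-distribʳ }
      ; *-comm = *ᴾ-comm }
    }

  constant-*ᴾ : ∀ c f → (∀ i → c (suc i) ≈ 0#) → ∀ n → (c *ᴾ f) n ≈ c 0 * f n
  constant-*ᴾ c f c≈ zero    = refl
  constant-*ᴾ c f c≈ (suc n) = begin
    sum≤ (suc n) (λ i → c i * f (suc n ∸ i))                ≈⟨ sum≤-suc n _ ⟩
    c 0 * f (suc n) + sum≤ n (λ i → c (suc i) * f (n ∸ i))  ≈⟨ +-congˡ (sum≤-zero n _ λ i → trans (*-congʳ (c≈ i)) (zeroˡ _)) ⟩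
    c 0 * f (suc n) + 0#                                    ≈⟨ +-identityʳ _ ⟩
    c 0 * f (suc n)                                         ∎

  monomial-suc-*ᴾ : ∀ k c f n → (monomial (suc k) c *ᴾ f) (suc n) ≈ (monomial k c *ᴾ f) n
  monomial-suc-*ᴾ k c f n =
    trans (sum≤-suc n _) (trans (+-congʳ (zeroˡ _)) (+-identityˡ _))

  monomial-*ᴾ-monomial : ∀ k k′ c c′ → monomial k c *ᴾ monomial k′ c′ ≈ᴾ monomial (k ℕ.+ k′) (c * c′)
  monomial-*ᴾ-monomial zero k′ c c′ n =
    trans (constant-*ᴾ (monomial 0 c) (monomial k′ c′) (λ _ → refl) n) (*-if (k′ ≡ᵇ n))
    where
    *-if : ∀ b → c * (if b then c′ else 0#) ≈ (if b then c * c′ else 0#)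
    *-if true  = refl
    *-if false = zeroʳ c
  monomial-*ᴾ-monomial (suc k) k′ c c′ zero    = zeroˡ _
  monomial-*ᴾ-monomial (suc k) k′ c c′ (suc n) =
    trans (monomial-suc-*ᴾ k c (monomial k′ c′) n) (monomial-*ᴾ-monomial k k′ c c′ n)

  monomial-cong : ∀ k {c c′} → c ≈ c′ → monomial k c ≈ᴾ monomial k c′
  monomial-cong k c≈c′ n with k ≡ᵇ n
  ... | true  = c≈c′
  ... | false = refl

module NestedPowerSeries (R : CommutativeRing 0ℓ 0ℓ) where
  private
    module Inner = FormalPowerSeries R
    module Outer = FormalPowerSeries Inner.commutativeRing

  sum≤-coefficient : ∀ n (h : ℕ → Inner.Series) m → Outer.sum≤ n h m ≡ Inner.sum≤ n (λ i → h i m)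
  sum≤-coefficient zero    h m = ≡.refl
  sum≤-coefficient (suc n) h m = ≡.cong (λ x → CommutativeRing._+_ R x (h (suc n) m)) (sum≤-coefficient n h m)

-- Ser as a commutative ring

-- Ser is definitionally S₄.Series, and _*ₛ_ agrees with the iterated Cauchy product
-- (*ₛ≡*ᴾ), so Ser inherits the ring laws.
module S₁ = FormalPowerSeries ℤ.+-*-commutativeRing
module S₂ = FormalPowerSeries S₁.commutativeRing
module S₃ = FormalPowerSeries S₂.commutativeRing
module S₄ = FormalPowerSeries S₃.commutativeRing

module N₁ = NestedPowerSeries ℤ.+-*-commutativeRing
module N₂ = NestedPowerSeries S₁.commutativeRing
module N₃ = NestedPowerSeries S₂.commutativeRing

module _ where
  open ≡ using (refl; cong; cong₂)

  infixl 6 _⊕_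
  infixl 7 _⊗_
  infix  8 ⊖_

  Σ≤-cong : ∀ n {f g : ℕ → ℤ} → (∀ i → f i ≡ g i) → Σ≤ n f ≡ Σ≤ n g
  Σ≤-cong zero    f≡g = f≡g 0
  Σ≤-cong (suc n) f≡g = cong₂ ℤ._+_ (Σ≤-cong n f≡g) (f≡g (suc n))

  sum≤≡Σ≤ : ∀ n f → S₁.sum≤ n f ≡ Σ≤ n f
  sum≤≡Σ≤ zero    f = refl
  sum≤≡Σ≤ (suc n) f = cong (ℤ._+ f (suc n)) (sum≤≡Σ≤ n f)

  private
    *₂-coefficient : ∀ f g c d →
      (f S₂.*ᴾ g) c d ≡ Σ≤ c (λ k → Σ≤ d (λ l → f k l ℤ.* g (c ∸ k) (d ∸ l)))
    *₂-coefficient f g c d = begin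
      S₂.sum≤ c (λ k → f k S₁.*ᴾ g (c ∸ k)) d    ≡⟨ N₁.sum≤-coefficient c _ d ⟩
      S₁.sum≤ c (λ k → (f k S₁.*ᴾ g (c ∸ k)) d)  ≡⟨ sum≤≡Σ≤ c _ ⟩
      Σ≤ c (λ k → (f k S₁.*ᴾ g (c ∸ k)) d)       ≡⟨ Σ≤-cong c (λ k → sum≤≡Σ≤ d _) ⟩
      Σ≤ c (λ k → Σ≤ d (λ l → f k l ℤ.* g (c ∸ k) (d ∸ l))) ∎
      where open ≡.≡-Reasoning

    *₃-coefficient : ∀ f g b c d → (f S₃.*ᴾ g) b c d ≡
      Σ≤ b (λ j → Σ≤ c (λ k → Σ≤ d (λ l → f j k l ℤ.* g (b ∸ j) (c ∸ k) (d ∸ l))))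
    *₃-coefficient f g b c d = begin
      S₃.sum≤ b (λ j → f j S₂.*ᴾ g (b ∸ j)) c d    ≡⟨ cong (λ h → h d) (N₂.sum≤-coefficient b _ c) ⟩
      S₂.sum≤ b (λ j → (f j S₂.*ᴾ g (b ∸ j)) c) d  ≡⟨ N₁.sum≤-coefficient b _ d ⟩
      S₁.sum≤ b (λ j → (f j S₂.*ᴾ g (b ∸ j)) c d)  ≡⟨ sum≤≡Σ≤ b _ ⟩
      Σ≤ b (λ j → (f j S₂.*ᴾ g (b ∸ j)) c d)       ≡⟨ Σ≤-cong b (λ j → *₂-coefficient (f j) (g (b ∸ j)) c d) ⟩
      Σ≤ b (λ j → Σ≤ c (λ k → Σ≤ d (λ l → f j k l ℤ.* g (b ∸ j) (c ∸ k) (d ∸ l)))) ∎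
      where open ≡.≡-Reasoning

  *ₛ≡*ᴾ : ∀ f g a b c d → (f *ₛ g) a b c d ≡ (f S₄.*ᴾ g) a b c d
  *ₛ≡*ᴾ f g a b c d = ≡.sym (begin
    S₄.sum≤ a (λ i → f i S₃.*ᴾ g (a ∸ i)) b c d    ≡⟨ cong (λ h → h c d) (N₃.sum≤-coefficient a _ b) ⟩
    S₃.sum≤ a (λ i → (f i S₃.*ᴾ g (a ∸ i)) b) c d  ≡⟨ cong (λ h → h d) (N₂.sum≤-coefficient a _ c) ⟩
    S₂.sum≤ a (λ i → (f i S₃.*ᴾ g (a ∸ i)) b c) d  ≡⟨ N₁.sum≤-coefficient a _ d ⟩
    S₁.sum≤ a (λ i → (f i S₃.*ᴾ g (a ∸ i)) b c d)  ≡⟨ sum≤≡Σ≤ a _ ⟩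
    Σ≤ a (λ i → (f i S₃.*ᴾ g (a ∸ i)) b c d)       ≡⟨ Σ≤-cong a (λ i → *₃-coefficient (f i) (g (a ∸ i)) b c d) ⟩
    (f *ₛ g) a b c d                               ∎)
    where open ≡.≡-Reasoning

  negₛ : Ser → Ser
  negₛ f a b c d = ℤ.- f a b c d

  zeroₛ : Ser
  zeroₛ _ _ _ _ = 0ℤ

  oneₛ≈1ᴾ : oneₛ ≈ₛ S₄.1ᴾ
  oneₛ≈1ᴾ zero    zero    zero    zero    = refl
  oneₛ≈1ᴾ zero    zero    zero    (suc d) = refl
  oneₛ≈1ᴾ zero    zero    (suc c) d       = refl
  oneₛ≈1ᴾ zero    (suc b) c       d       = refl
  oneₛ≈1ᴾ (suc a) b       c       d       = refl

  -- A record rather than ≈ₛ itself, so that both sides stay inferable from an equation.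
  infix 4 _≋_
  record _≋_ (f g : Ser) : Set where
    constructor mk≋
    field get : f ≈ₛ g
  open _≋_ public

  ≋-refl : ∀ {f} → f ≋ f
  ≋-refl = mk≋ λ _ _ _ _ → refl

  ≋-sym : ∀ {f g} → f ≋ g → g ≋ f
  ≋-sym (mk≋ e) = mk≋ λ a b c d → ≡.sym (e a b c d)

  ≋-trans : ∀ {f g h} → f ≋ g → g ≋ h → f ≋ h
  ≋-trans (mk≋ e) (mk≋ e′) = mk≋ λ a b c d → ≡.trans (e a b c d) (e′ a b c d)

  *ₛ≋*ᴾ : ∀ f g → f *ₛ g ≋ f S₄.*ᴾ g
  *ₛ≋*ᴾ f g = mk≋ (*ₛ≡*ᴾ f g)

  private
    module S₄-ring = CommutativeRing S₄.commutativeRing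

    via-*ᴾ : ∀ f g f′ g′ → f S₄.*ᴾ g S₄.≈ᴾ f′ S₄.*ᴾ g′ → f *ₛ g ≋ f′ *ₛ g′
    via-*ᴾ f g f′ g′ e =
      ≋-trans (*ₛ≋*ᴾ f g) (≋-trans (mk≋ e) (≋-sym (*ₛ≋*ᴾ f′ g′)))

  *ₛ-cong : ∀ {f f′ g g′} → f ≋ f′ → g ≋ g′ → f *ₛ g ≋ f′ *ₛ g′
  *ₛ-cong {f} {f′} {g} {g′} (mk≋ f≈) (mk≋ g≈) = via-*ᴾ f g f′ g′ (S₄.*ᴾ-cong {f} {f′} {g} {g′} f≈ g≈)

  *ₛ-comm : ∀ f g → f *ₛ g ≋ g *ₛ f
  *ₛ-comm f g = via-*ᴾ f g g f (S₄.*ᴾ-comm f g)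

  *ₛ-assoc : ∀ f g h → (f *ₛ g) *ₛ h ≋ f *ₛ (g *ₛ h)
  *ₛ-assoc f g h = mk≋ (begin
    (f *ₛ g) *ₛ h            ≈⟨ *ₛ≡*ᴾ (f *ₛ g) h ⟩
    (f *ₛ g) S₄.*ᴾ h         ≈⟨ S₄.*ᴾ-congʳ h (*ₛ≡*ᴾ f g) ⟩
    (f S₄.*ᴾ g) S₄.*ᴾ h      ≈⟨ S₄.*ᴾ-assoc f g h ⟩
    f S₄.*ᴾ (g S₄.*ᴾ h)      ≈⟨ S₄.*ᴾ-congˡ f (*ₛ≡*ᴾ g h) ⟨
    f S₄.*ᴾ (g *ₛ h)         ≈⟨ *ₛ≡*ᴾ f (g *ₛ h) ⟨
    f *ₛ (g *ₛ h)            ∎)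
    where open import Relation.Binary.Reasoning.Setoid S₄-ring.setoid

  *ₛ-identityˡ : ∀ f → oneₛ *ₛ f ≋ f
  *ₛ-identityˡ f = ≋-trans (*ₛ≋*ᴾ oneₛ f)
    (mk≋ (S₄-ring.trans {oneₛ S₄.*ᴾ f} (S₄.*ᴾ-congʳ f oneₛ≈1ᴾ) (S₄.*ᴾ-identityˡ f)))

  *ₛ-distribˡ : ∀ f g h → f *ₛ (g +ₛ h) ≋ (f *ₛ g) +ₛ (f *ₛ h)
  *ₛ-distribˡ f g h = mk≋ λ a b c d → ≡.trans (*ₛ≡*ᴾ f (g +ₛ h) a b c d)
    (≡.trans (S₄.*ᴾ-distribˡ f g h a b c d)
    (cong₂ ℤ._+_ (≡.sym (*ₛ≡*ᴾ f g a b c d)) (≡.sym (*ₛ≡*ᴾ f h a b c d))))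

  isCommutativeRingₛ : IsCommutativeRing _≋_ _+ₛ_ _*ₛ_ negₛ zeroₛ oneₛ
  isCommutativeRingₛ = record
    { isRing = record
      { +-isAbelianGroup = record
        { isGroup = record
          { isMonoid = record
            { isSemigroup = record
              { isMagma = record
                { isEquivalence = record { refl = ≋-refl ; sym = ≋-sym ; trans = ≋-trans }
                ; ∙-cong = λ (mk≋ e) (mk≋ e′) → mk≋ λ a b c d → cong₂ ℤ._+_ (e a b c d) (e′ a b c d) }
              ; assoc = λ f g h → mk≋ λ a b c d → ℤ.+-assoc (f a b c d) _ _ }
            ; identity = (λ f → mk≋ λ a b c d → ℤ.+-identityˡ _) , (λ f → mk≋ λ a b c d → ℤ.+-identityʳ _) }
          ; inverse = (λ f → mk≋ λ a b c d → ℤ.+-inverseˡ (f a b c d)) , (λ f → mk≋ λ a b c d → ℤ.+-inverseʳ (f a b c d))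
          ; ⁻¹-cong = λ (mk≋ e) → mk≋ λ a b c d → cong ℤ.-_ (e a b c d) }
        ; comm = λ f g → mk≋ λ a b c d → ℤ.+-comm (f a b c d) _ }
      ; *-cong = *ₛ-cong
      ; *-assoc = *ₛ-assoc
      ; *-identity = *ₛ-identityˡ , λ f → ≋-trans (*ₛ-comm f oneₛ) (*ₛ-identityˡ f)
      ; distrib = *ₛ-distribˡ , λ f g h → ≋-trans (*ₛ-comm (g +ₛ h) f) (≋-trans (*ₛ-distribˡ f g h)
                    (mk≋ λ a b c d → cong₂ ℤ._+_ (get (*ₛ-comm f g) a b c d) (get (*ₛ-comm f h) a b c d)))
      }
    ; *-comm = *ₛ-comm
    }

  -- Opaque copies of the operations, so that checking the ring solver's normal forms
  -- never unfolds a Cauchy product.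
  opaque
    _⊕_ _⊗_ : Ser → Ser → Ser
    _⊕_ = _+ₛ_
    _⊗_ = _*ₛ_

    ⊖_ : Ser → Ser
    ⊖_ = negₛ

  opaque
    unfolding _⊕_

    ⊕-coefficient : ∀ f g a b c d → (f ⊕ g) a b c d ≡ f a b c d ℤ.+ g a b c d
    ⊕-coefficient f g a b c d = refl

    ⊗-coefficient : ∀ f g a b c d → (f ⊗ g) a b c d ≡ (f *ₛ g) a b c d
    ⊗-coefficient f g a b c d = refl

    ⊖-coefficient : ∀ f a b c d → (⊖ f) a b c d ≡ ℤ.- f a b c d
    ⊖-coefficient f a b c d = refl

    -ₛ≋⊕⊖ : ∀ f g → (f -ₛ g) ≋ f ⊕ ⊖ g
    -ₛ≋⊕⊖ f g = ≋-refl

    isCommutativeRing : IsCommutativeRing _≋_ _⊕_ _⊗_ ⊖_ zeroₛ oneₛ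
    isCommutativeRing = isCommutativeRingₛ

ring : CommutativeRing 0ℓ 0ℓ
ring = record { isCommutativeRing = isCommutativeRing }

module SR = CommutativeRing ring

module _ where
  open ≡ using (refl; cong)
  open import Algebra.Solver.Ring.AlmostCommutativeRing
  open import Relation.Nullary using (yes; no)

  infix 4 _≈₃_
  _≈₃_ : S₃.Series → S₃.Series → Set
  _≈₃_ = S₃._≈ᴾ_

  trans₃ : ∀ {f g h} → f ≈₃ g → g ≈₃ h → f ≈₃ h
  trans₃ e e′ b c d = ≡.trans (e b c d) (e′ b c d)

  sym₃ : ∀ {f g} → f ≈₃ g → g ≈₃ f
  sym₃ e b c d = ≡.sym (e b c d)

  constant : ℤ → Ser
  constant z a b c d = if (0 ≡ᵇ a) ∧ (0 ≡ᵇ b) ∧ (0 ≡ᵇ c) ∧ (0 ≡ᵇ d) then z else 0ℤ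

  FreeOfU : Ser → Set
  FreeOfU f = ∀ i b c d → f (suc i) b c d ≡ 0ℤ

  FreeOfU-*ₛ : ∀ k → FreeOfU k → ∀ f a → (k *ₛ f) a ≈₃ k 0 S₃.*ᴾ f a
  FreeOfU-*ₛ k k-free f a = trans₃ (*ₛ≡*ᴾ k f a) (S₄.constant-*ᴾ k f k-free a)

  FreeOfU-⊗ : ∀ k → FreeOfU k → ∀ f a → (k ⊗ f) a ≈₃ k 0 S₃.*ᴾ f a
  FreeOfU-⊗ k k-free f a = trans₃ (⊗-coefficient k f a) (FreeOfU-*ₛ k k-free f a)

  constant-*ₛ : ∀ x f a b c d → (constant x *ₛ f) a b c d ≡ x ℤ.* f a b c d
  constant-*ₛ x f a b c d = begin
    (constant x *ₛ f) a b c d                                  ≡⟨ FreeOfU-*ₛ (constant x) (λ _ _ _ _ → refl) f a b c d ⟩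
    (constant x 0 S₃.*ᴾ f a) b c d                             ≡⟨ S₃.constant-*ᴾ (constant x 0) (f a) (λ _ _ _ → refl) b c d ⟩
    (constant x 0 0 S₂.*ᴾ f a b) c d                           ≡⟨ S₂.constant-*ᴾ (constant x 0 0) (f a b) (λ _ _ → refl) c d ⟩
    (constant x 0 0 0 S₁.*ᴾ f a b c) d                         ≡⟨ S₁.constant-*ᴾ (constant x 0 0 0) (f a b c) (λ _ → refl) d ⟩
    x ℤ.* f a b c d                                            ∎
    where open ≡.≡-Reasoning

  private
    at-origin : ℕ → ℕ → ℕ → ℕ → Bool
    at-origin a b c d = (0 ≡ᵇ a) ∧ (0 ≡ᵇ b) ∧ (0 ≡ᵇ c) ∧ (0 ≡ᵇ d)

  constant-+ : ∀ x y → constant (x ℤ.+ y) ≈ₛ (constant x +ₛ constant y)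
  constant-+ x y a b c d with at-origin a b c d
  ... | true  = refl
  ... | false = refl

  constant-* : ∀ x y → constant (x ℤ.* y) ≈ₛ (constant x *ₛ constant y)
  constant-* x y a b c d = ≡.trans scale (≡.sym (constant-*ₛ x (constant y) a b c d))
    where
    scale : constant (x ℤ.* y) a b c d ≡ x ℤ.* constant y a b c d
    scale with at-origin a b c d
    ... | true  = refl
    ... | false = ≡.sym (ℤ.*-zeroʳ x)

  constant-neg : ∀ x → constant (ℤ.- x) ≈ₛ negₛ (constant x)
  constant-neg x a b c d with at-origin a b c d
  ... | true  = refl
  ... | false = refl

  -- The solver interprets the coefficients 0 and 1 by cst; with this choice they
  -- are definitionally zeroₛ and oneₛ, so solved identities may mention them.
  cst : ℤ → Ser
  cst (ℤ.+ 0) = zeroₛ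
  cst z       = constant z

  cst≈constant : ∀ z → cst z ≈ₛ constant z
  cst≈constant (ℤ.+ 0) a b c d with at-origin a b c d
  ... | true  = refl
  ... | false = refl
  cst≈constant (ℤ.+ suc n) a b c d = refl
  cst≈constant ℤ.-[1+ n ]  a b c d = refl

  private
    via-constant : ∀ {z f} → constant z ≈ₛ f → cst z ≋ f
    via-constant {z} e = mk≋ λ a b c d → ≡.trans (cst≈constant z a b c d) (e a b c d)

  cst-morphism : ℤ.+-*-rawRing -Raw-AlmostCommutative⟶ fromCommutativeRing ring
  cst-morphism = record
    { ⟦_⟧    = cst
    ; +-homo = λ x y → via-constant λ a b c d →
                 ≡.trans (constant-+ x y a b c d) (≡.sym (≡.trans (⊕-coefficient (cst x) (cst y) a b c d)
                   (≡.cong₂ ℤ._+_ (cst≈constant x a b c d) (cst≈constant y a b c d))))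
    ; *-homo = λ x y → via-constant λ a b c d →
                 ≡.trans (constant-* x y a b c d) (≡.sym (≡.trans (⊗-coefficient (cst x) (cst y) a b c d)
                   (get (*ₛ-cong (via-constant λ _ _ _ _ → refl) (via-constant λ _ _ _ _ → refl)) a b c d)))
    ; -‿homo = λ x → via-constant λ a b c d →
                 ≡.trans (constant-neg x a b c d) (≡.sym (≡.trans (⊖-coefficient (cst x) a b c d)
                   (cong ℤ.-_ (cst≈constant x a b c d))))
    ; 0-homo = ≋-refl
    ; 1-homo = ≋-refl
    }

  cst-≟ : ∀ x y → Maybe (cst x ≋ cst y)
  cst-≟ x y with x ℤ.≟ y
  ... | yes refl = just ≋-refl
  ... | no _     = nothing

  open import Algebra.Solver.Ring ℤ.+-*-rawRing (fromCommutativeRing ring) cst-morphism cst-≟ public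

module _ where
  open ≡ using (refl)

  nested-monomial : ℕ → ℕ → ℕ → ℕ → Ser
  nested-monomial a b c d = S₄.monomial a (S₃.monomial b (S₂.monomial c (S₁.monomial d 1ℤ)))

  mono≈nested-monomial : ∀ a b c d → mono a b c d ≈ₛ nested-monomial a b c d
  mono≈nested-monomial a b c d a′ b′ c′ d′ with a ≡ᵇ a′
  ... | false = refl
  ... | true  with b ≡ᵇ b′
  ...   | false = refl
  ...   | true  with c ≡ᵇ c′
  ...     | false = refl
  ...     | true  = refl

  mono-*ₛ-mono : ∀ a b c d a′ b′ c′ d′ →
    (mono a b c d *ₛ mono a′ b′ c′ d′) ≈ₛ mono (a ℕ.+ a′) (b ℕ.+ b′) (c ℕ.+ c′) (d ℕ.+ d′)
  mono-*ₛ-mono a b c d a′ b′ c′ d′ = get (begin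
    mono a b c d *ₛ mono a′ b′ c′ d′
      ≈⟨ *ₛ-cong (mk≋ (mono≈nested-monomial a b c d)) (mk≋ (mono≈nested-monomial a′ b′ c′ d′)) ⟩
    nested-monomial a b c d *ₛ nested-monomial a′ b′ c′ d′
      ≈⟨ *ₛ≋*ᴾ (nested-monomial a b c d) (nested-monomial a′ b′ c′ d′) ⟩
    nested-monomial a b c d S₄.*ᴾ nested-monomial a′ b′ c′ d′
      ≈⟨ mk≋ (S₄.monomial-*ᴾ-monomial a a′ _ _) ⟩
    S₄.monomial (a ℕ.+ a′) (S₃.monomial b (S₂.monomial c (S₁.monomial d 1ℤ))
                        S₃.*ᴾ S₃.monomial b′ (S₂.monomial c′ (S₁.monomial d′ 1ℤ)))
      ≈⟨ mk≋ (S₄.monomial-cong (a ℕ.+ a′) (S₃.monomial-*ᴾ-monomial b b′ _ _)) ⟩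
    S₄.monomial (a ℕ.+ a′) (S₃.monomial (b ℕ.+ b′) (S₂.monomial c (S₁.monomial d 1ℤ)
                        S₂.*ᴾ S₂.monomial c′ (S₁.monomial d′ 1ℤ)))
      ≈⟨ mk≋ (S₄.monomial-cong (a ℕ.+ a′) (S₃.monomial-cong (b ℕ.+ b′) (S₂.monomial-*ᴾ-monomial c c′ _ _))) ⟩
    S₄.monomial (a ℕ.+ a′) (S₃.monomial (b ℕ.+ b′) (S₂.monomial (c ℕ.+ c′)
                        (S₁.monomial d 1ℤ S₁.*ᴾ S₁.monomial d′ 1ℤ)))
      ≈⟨ mk≋ (S₄.monomial-cong (a ℕ.+ a′) (S₃.monomial-cong (b ℕ.+ b′) (S₂.monomial-cong (c ℕ.+ c′)
            (S₁.monomial-*ᴾ-monomial d d′ _ _)))) ⟩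
    nested-monomial (a ℕ.+ a′) (b ℕ.+ b′) (c ℕ.+ c′) (d ℕ.+ d′)
      ≈⟨ mk≋ (mono≈nested-monomial (a ℕ.+ a′) (b ℕ.+ b′) (c ℕ.+ c′) (d ℕ.+ d′)) ⟨
    mono (a ℕ.+ a′) (b ℕ.+ b′) (c ℕ.+ c′) (d ℕ.+ d′) ∎)
    where
    open import Relation.Binary.Reasoning.Setoid SR.setoid

  mono-⊗-mono : ∀ a b c d a′ b′ c′ d′ →
    mono a b c d ⊗ mono a′ b′ c′ d′ ≋ mono (a ℕ.+ a′) (b ℕ.+ b′) (c ℕ.+ c′) (d ℕ.+ d′)
  mono-⊗-mono a b c d a′ b′ c′ d′ = mk≋ λ a″ b″ c″ d″ →
    ≡.trans (⊗-coefficient (mono a b c d) _ a″ b″ c″ d″) (mono-*ₛ-mono a b c d a′ b′ c′ d′ a″ b″ c″ d″)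

  mono-cong : ∀ a {b b′} c {d d′} → b ≡ b′ → d ≡ d′ → mono a b c d ≋ mono a b′ c d′
  mono-cong a c refl refl = ≋-refl

  mono-FreeOfU : ∀ b c d → FreeOfU (mono 0 b c d)
  mono-FreeOfU b c d i b′ c′ d′ = refl

  U≈monomial : U ≈ₛ S₄.monomial 1 (oneₛ 0)
  U≈monomial a b c d with 1 ≡ᵇ a
  ... | true  = refl
  ... | false = refl

  U-⊗-suc : ∀ f a → (U ⊗ f) (suc a) ≈₃ f a
  U-⊗-suc f a =
    trans₃ (⊗-coefficient U f (suc a))
    (trans₃ (get (*ₛ-cong (mk≋ U≈monomial) (≋-refl {f})) (suc a))
    (trans₃ (*ₛ≡*ᴾ (S₄.monomial 1 (oneₛ 0)) f (suc a))
    (trans₃ (S₄.monomial-suc-*ᴾ 0 (oneₛ 0) f a)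
    (trans₃ (S₄.constant-*ᴾ (S₄.monomial 0 (oneₛ 0)) f (λ _ _ _ _ → refl) a)
    (trans₃ {g = S₃.1ᴾ S₃.*ᴾ f a} (S₃.*ᴾ-congʳ (f a) (oneₛ≈1ᴾ 0)) (S₃.*ᴾ-identityˡ (f a)))))))

  U-⊗-zero : ∀ f → (U ⊗ f) 0 ≈₃ S₃.0ᴾ
  U-⊗-zero f =
    trans₃ (⊗-coefficient U f 0)
    (trans₃ (get (*ₛ-cong (mk≋ U≈monomial) (≋-refl {f})) 0)
    (trans₃ (*ₛ≡*ᴾ (S₄.monomial 1 (oneₛ 0)) f 0) (CommutativeRing.zeroˡ S₃.commutativeRing (f 0))))

-- Existence and uniqueness of the factorization w = u h₁ ⋯ hₖ

Factorization : Set
Factorization = List ℕ × List (List ℕ)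

consFactorization : ℕ → Factorization → Factorization
consFactorization y ([]    , hs) = (y ∷ [] , hs)
consFactorization y (z ∷ v , hs) = if z ≤ᵇ y then (y ∷ z ∷ v , hs) else ([] , (y ∷ z ∷ v) ∷ hs)

factorization : List ℕ → Factorization
factorization []      = ([] , [])
factorization (y ∷ w) = consFactorization y (factorization w)

prefix : List ℕ → List ℕ
prefix w = proj₁ (factorization w)

hwords : List ℕ → List (List ℕ)
hwords w = proj₂ (factorization w)

module _ where
  open ≡ using (refl; cong; cong₂; sym; trans)
  open ≡.≡-Reasoning

  isNil : List ℕ → Bool
  isNil []      = true
  isNil (_ ∷ _) = false

  <ᵇ-suc : ∀ z y → (z <ᵇ suc y) ≡ (z ≤ᵇ y)
  <ᵇ-suc zero    y = refl
  <ᵇ-suc (suc z) y = refl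

  ≤ᵇ≡not<ᵇ : ∀ z y → (z ≤ᵇ y) ≡ not (y <ᵇ z)
  ≤ᵇ≡not<ᵇ zero    zero    = refl
  ≤ᵇ≡not<ᵇ zero    (suc y) = refl
  ≤ᵇ≡not<ᵇ (suc z) zero    = refl
  ≤ᵇ≡not<ᵇ (suc z) (suc y) = trans (<ᵇ-suc z y) (≤ᵇ≡not<ᵇ z y)

  sum-map-++ : ∀ {A : Set} (f : A → ℕ) xs ys → sum (map f (xs ++ ys)) ≡ sum (map f xs) ℕ.+ sum (map f ys)
  sum-map-++ f xs ys = trans (cong sum (List.map-++ f xs ys)) (ℕ.sum-++ (map f xs) (map f ys))

  sum-map-cong : ∀ {A : Set} {f g : A → ℕ} xs → (∀ x → f x ≡ g x) → sum (map f xs) ≡ sum (map g xs)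
  sum-map-cong xs f≗g = cong sum (List.map-cong f≗g xs)

  sum-map-+ : ∀ {A : Set} (f g : A → ℕ) xs → sum (map (λ x → f x ℕ.+ g x) xs) ≡ sum (map f xs) ℕ.+ sum (map g xs)
  sum-map-+ f g []       = refl
  sum-map-+ f g (x ∷ xs) =
    trans (cong (f x ℕ.+ g x ℕ.+_) (sum-map-+ f g xs)) (CommSemigroupProperties.interchange ℕ.+-commutativeSemigroup (f x) (g x) _ _)

  sum-map-concatMap : ∀ {A B : Set} (f : B → ℕ) (g : A → List B) xs →
    sum (map f (concatMap g xs)) ≡ sum (map (λ x → sum (map f (g x))) xs)
  sum-map-concatMap f g []       = refl
  sum-map-concatMap f g (x ∷ xs) =
    trans (sum-map-++ f (g x) (concatMap g xs)) (cong (sum (map f (g x)) ℕ.+_) (sum-map-concatMap f g xs))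

  sum-map-map : ∀ {A B : Set} (f : B → ℕ) (g : A → B) xs → sum (map f (map g xs)) ≡ sum (map (λ x → f (g x)) xs)
  sum-map-map f g xs = cong sum (sym (List.map-∘ xs))

  nonincThenH : (List ℕ → List (List ℕ) → ℕ) → List (List ℕ) → ℕ
  nonincThenH χ []       = 0
  nonincThenH χ (b ∷ bs) = if noninc b ∧ allH bs then χ b bs else 0

  closeH : ℕ → (List (List ℕ) → ℕ) → List ℕ → List (List ℕ) → ℕ
  closeH y χ []      bs = 0
  closeH y χ (z ∷ b) bs = if y <ᵇ z then χ ((y ∷ z ∷ b) ∷ bs) else 0

  extendHead : ℕ → (List ℕ → List (List ℕ) → ℕ) → List ℕ → List (List ℕ) → ℕ
  extendHead y χ []      bs = χ (y ∷ []) bs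
  extendHead y χ (z ∷ b) bs = if z ≤ᵇ y then χ (y ∷ z ∷ b) bs else 0

  prependBlock-allH : ∀ y (χ : List (List ℕ) → ℕ) c →
    sum (map (λ c → if allH c then χ c else 0) (prependBlock y c)) ≡ nonincThenH (closeH y χ) c
  prependBlock-allH y χ []             = refl
  prependBlock-allH y χ ([] ∷ bs)      with allH bs
  ... | true  = refl
  ... | false = refl
  prependBlock-allH y χ ((z ∷ b) ∷ bs) with y <ᵇ z | noninc (z ∷ b) | allH bs
  ... | true  | true  | true  = ℕ.+-identityʳ _
  ... | true  | true  | false = refl
  ... | true  | false | _     = refl
  ... | false | true  | true  = refl
  ... | false | true  | false = refl
  ... | false | false | _     = refl

  consFactorization-allH : ∀ y (χ : List (List ℕ) → ℕ) F →
    (if isNil (proj₁ F) then 0 else closeH y χ (proj₁ F) (proj₂ F)) ≡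
    (if isNil (proj₁ (consFactorization y F)) then χ (proj₂ (consFactorization y F)) else 0)
  consFactorization-allH y χ ([]    , hs) = refl
  consFactorization-allH y χ (z ∷ v , hs) rewrite ≤ᵇ≡not<ᵇ z y with y <ᵇ z
  ... | true  = refl
  ... | false = refl

  prependBlock-nonincThenH : ∀ y (χ : List ℕ → List (List ℕ) → ℕ) c →
    sum (map (nonincThenH χ) (prependBlock y c)) ≡
    (if allH c then χ (y ∷ []) c else 0) ℕ.+ nonincThenH (extendHead y χ) c
  prependBlock-nonincThenH y χ []             = refl
  prependBlock-nonincThenH y χ ([] ∷ bs)      with allH bs
  ... | true  = ℕ.+-identityʳ _
  ... | false = refl
  prependBlock-nonincThenH y χ ((z ∷ b) ∷ bs) with isH (z ∷ b) ∧ allH bs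
  ... | false with z ≤ᵇ y | noninc (z ∷ b) | allH bs
  ...   | true  | true  | true  = ℕ.+-identityʳ _
  ...   | true  | true  | false = refl
  ...   | true  | false | _     = refl
  ...   | false | true  | true  = refl
  ...   | false | true  | false = refl
  ...   | false | false | _     = refl
  prependBlock-nonincThenH y χ ((z ∷ b) ∷ bs) | true with z ≤ᵇ y | noninc (z ∷ b) | allH bs
  ...   | true  | true  | true  = cong (χ (y ∷ []) ((z ∷ b) ∷ bs) ℕ.+_) (ℕ.+-identityʳ _)
  ...   | true  | true  | false = refl
  ...   | true  | false | _     = refl
  ...   | false | true  | true  = refl
  ...   | false | true  | false = refl
  ...   | false | false | _     = refl

  consFactorization-nonincThenH : ∀ y (χ : List ℕ → List (List ℕ) → ℕ) F →
    (if isNil (proj₁ F) then χ (y ∷ []) (proj₂ F) else 0) ℕ.+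
    (if isNil (proj₁ F) then 0 else extendHead y χ (proj₁ F) (proj₂ F)) ≡
    (if isNil (proj₁ (consFactorization y F)) then 0
     else χ (proj₁ (consFactorization y F)) (proj₂ (consFactorization y F)))
  consFactorization-nonincThenH y χ ([]    , hs) = ℕ.+-identityʳ _
  consFactorization-nonincThenH y χ (z ∷ v , hs) with z ≤ᵇ y
  ... | true  = refl
  ... | false = refl

  -- w is a product of H-words exactly when its prefix is empty, and then in one way only.
  sum-allH-compositions : ∀ w (χ : List (List ℕ) → ℕ) →
    sum (map (λ c → if allH c then χ c else 0) (compositions w)) ≡
    (if isNil (prefix w) then χ (hwords w) else 0)

  sum-nonincThenH-compositions : ∀ w (χ : List ℕ → List (List ℕ) → ℕ) →
    sum (map (nonincThenH χ) (compositions w)) ≡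
    (if isNil (prefix w) then 0 else χ (prefix w) (hwords w))

  sum-allH-compositions []      χ = ℕ.+-identityʳ _
  sum-allH-compositions (y ∷ w) χ = begin
    sum (map (λ c → if allH c then χ c else 0) (concatMap (prependBlock y) (compositions w)))
      ≡⟨ sum-map-concatMap _ (prependBlock y) (compositions w) ⟩
    sum (map (λ c → sum (map (λ c → if allH c then χ c else 0) (prependBlock y c))) (compositions w))
      ≡⟨ sum-map-cong (compositions w) (prependBlock-allH y χ) ⟩
    sum (map (nonincThenH (closeH y χ)) (compositions w))
      ≡⟨ sum-nonincThenH-compositions w (closeH y χ) ⟩
    (if isNil (prefix w) then 0 else closeH y χ (prefix w) (hwords w))
      ≡⟨ consFactorization-allH y χ (factorization w) ⟩
    (if isNil (prefix (y ∷ w)) then χ (hwords (y ∷ w)) else 0)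
      ∎

  sum-nonincThenH-compositions []      χ = refl
  sum-nonincThenH-compositions (y ∷ w) χ = begin
    sum (map (nonincThenH χ) (concatMap (prependBlock y) (compositions w)))
      ≡⟨ sum-map-concatMap _ (prependBlock y) (compositions w) ⟩
    sum (map (λ c → sum (map (nonincThenH χ) (prependBlock y c))) (compositions w))
      ≡⟨ sum-map-cong (compositions w) (prependBlock-nonincThenH y χ) ⟩
    sum (map (λ c → (if allH c then χ (y ∷ []) c else 0) ℕ.+ nonincThenH (extendHead y χ) c) (compositions w))
      ≡⟨ sum-map-+ _ _ (compositions w) ⟩
    sum (map (λ c → if allH c then χ (y ∷ []) c else 0) (compositions w)) ℕ.+
    sum (map (nonincThenH (extendHead y χ)) (compositions w))
      ≡⟨ cong₂ ℕ._+_ (sum-allH-compositions w (χ (y ∷ []))) (sum-nonincThenH-compositions w (extendHead y χ)) ⟩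
    (if isNil (prefix w) then χ (y ∷ []) (hwords w) else 0) ℕ.+
    (if isNil (prefix w) then 0 else extendHead y χ (prefix w) (hwords w))
      ≡⟨ consFactorization-nonincThenH y χ (factorization w) ⟩
    (if isNil (prefix (y ∷ w)) then 0 else χ (prefix (y ∷ w)) (hwords (y ∷ w)))
      ∎

  candidates-∷ : ∀ y w → candidates (y ∷ w) ≡
    map ([] ,_) (compositions (y ∷ w)) ++ map (map₁ (y ∷_)) (candidates w)
  candidates-∷ y w = begin
    candidates (y ∷ w)
      ≡⟨ candidates≡ (y ∷ w) ⟩
    map ([] ,_) (compositions (y ∷ w)) ++ concatMap afterPrefix (map (λ { (p , s) → (y ∷ p , s) }) (splits w))
      ≡⟨ cong (λ l → closedPart ++ concatMap afterPrefix l) (List.map-cong (λ { (p , s) → refl }) (splits w)) ⟩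
    map ([] ,_) (compositions (y ∷ w)) ++ concatMap afterPrefix (map (map₁ (y ∷_)) (splits w))
      ≡⟨ cong (closedPart ++_) (List.concatMap-map afterPrefix _ (splits w)) ⟩
    map ([] ,_) (compositions (y ∷ w)) ++ concatMap (λ F → afterPrefix (map₁ (y ∷_) F)) (splits w)
      ≡⟨ cong (closedPart ++_) (List.concatMap-cong (λ { (p , s) → List.map-∘ (compositions s) }) (splits w)) ⟩
    map ([] ,_) (compositions (y ∷ w)) ++ concatMap (λ F → map (map₁ (y ∷_)) (afterPrefix F)) (splits w)
      ≡⟨ cong (closedPart ++_) (List.map-concatMap _ afterPrefix (splits w)) ⟨
    map ([] ,_) (compositions (y ∷ w)) ++ map (map₁ (y ∷_)) (concatMap afterPrefix (splits w))
      ≡⟨ cong (λ l → closedPart ++ map (map₁ (y ∷_)) l) (candidates≡ w) ⟨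
    map ([] ,_) (compositions (y ∷ w)) ++ map (map₁ (y ∷_)) (candidates w)
      ∎
    where
    closedPart : List Factorization
    closedPart = map ([] ,_) (compositions (y ∷ w))

    afterPrefix : List ℕ × List ℕ → List Factorization
    afterPrefix (u , v) = map (u ,_) (compositions v)

    candidates≡ : ∀ w → candidates w ≡ concatMap afterPrefix (splits w)
    candidates≡ w = List.concatMap-cong (λ { (u , v) → refl }) (splits w)

  extendPrefix : ℕ → (Factorization → ℕ) → Factorization → ℕ
  extendPrefix y φ ([]    , hs) = φ (y ∷ [] , hs)
  extendPrefix y φ (z ∷ u , hs) = if z ≤ᵇ y then φ (y ∷ z ∷ u , hs) else 0

  isFactorization-∷ : ∀ y (φ : Factorization → ℕ) F →
    (if isFactorization (map₁ (y ∷_) F) then φ (map₁ (y ∷_) F) else 0) ≡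
    (if isFactorization F then extendPrefix y φ F else 0)
  isFactorization-∷ y φ ([]    , hs) = refl
  isFactorization-∷ y φ (z ∷ u , hs) with z ≤ᵇ y | noninc (z ∷ u) | allH hs
  ... | true  | true  | true  = refl
  ... | true  | true  | false = refl
  ... | true  | false | _     = refl
  ... | false | true  | true  = refl
  ... | false | true  | false = refl
  ... | false | false | _     = refl

  consFactorization-split : ∀ y (φ : Factorization → ℕ) F →
    (if isNil (proj₁ (consFactorization y F)) then φ ([] , proj₂ (consFactorization y F)) else 0) ℕ.+
    extendPrefix y φ F ≡ φ (consFactorization y F)
  consFactorization-split y φ ([]    , hs) = refl
  consFactorization-split y φ (z ∷ v , hs) with z ≤ᵇ y
  ... | true  = refl
  ... | false = ℕ.+-identityʳ _

  sum-factorizations : ∀ w (φ : Factorization → ℕ) →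
    sum (map (λ F → if isFactorization F then φ F else 0) (candidates w)) ≡ φ (factorization w)
  sum-factorizations []      φ = ℕ.+-identityʳ _
  sum-factorizations (y ∷ w) φ = begin
    sum (map ψ (candidates (y ∷ w)))
      ≡⟨ cong (λ l → sum (map ψ l)) (candidates-∷ y w) ⟩
    sum (map ψ (map ([] ,_) (compositions (y ∷ w)) ++ map (map₁ (y ∷_)) (candidates w)))
      ≡⟨ sum-map-++ ψ (map ([] ,_) (compositions (y ∷ w))) _ ⟩
    sum (map ψ (map ([] ,_) (compositions (y ∷ w)))) ℕ.+ sum (map ψ (map (map₁ (y ∷_)) (candidates w)))
      ≡⟨ cong₂ ℕ._+_ (sum-map-map ψ ([] ,_) (compositions (y ∷ w))) (sum-map-map ψ (map₁ (y ∷_)) (candidates w)) ⟩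
    sum (map (λ c → if allH c then φ ([] , c) else 0) (compositions (y ∷ w))) ℕ.+
    sum (map (λ F → ψ (map₁ (y ∷_) F)) (candidates w))
      ≡⟨ cong₂ ℕ._+_ (sum-allH-compositions (y ∷ w) (λ c → φ ([] , c)))
                     (sum-map-cong (candidates w) (isFactorization-∷ y φ)) ⟩
    (if isNil (prefix (y ∷ w)) then φ ([] , hwords (y ∷ w)) else 0) ℕ.+
    sum (map (λ F → if isFactorization F then extendPrefix y φ F else 0) (candidates w))
      ≡⟨ cong ((if isNil (prefix (y ∷ w)) then φ ([] , hwords (y ∷ w)) else 0) ℕ.+_) (sum-factorizations w (extendPrefix y φ)) ⟩
    (if isNil (prefix (y ∷ w)) then φ ([] , hwords (y ∷ w)) else 0) ℕ.+ extendPrefix y φ (factorization w)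
      ≡⟨ consFactorization-split y φ (factorization w) ⟩
    φ (factorization (y ∷ w))
      ∎
    where
    ψ : Factorization → ℕ
    ψ F = if isFactorization F then φ F else 0

  countFact≡indicator : ∀ b c d w → countFact b c d w ≡
    indicator ((wlecF (factorization w) ≡ᵇ b) ∧ (tot w ≡ᵇ c) ∧ (wpixF (factorization w) ≡ᵇ d))
  countFact≡indicator b c d w =
    trans (sum-map-cong (candidates w) indicator-∧)
          (sum-factorizations w λ F → indicator ((wlecF F ≡ᵇ b) ∧ (tot w ≡ᵇ c) ∧ (wpixF F ≡ᵇ d)))
    where
    indicator-∧ : ∀ F → indicator (isFactorization F ∧ (wlecF F ≡ᵇ b) ∧ (tot w ≡ᵇ c) ∧ (wpixF F ≡ᵇ d)) ≡
                        (if isFactorization F then indicator ((wlecF F ≡ᵇ b) ∧ (tot w ≡ᵇ c) ∧ (wpixF F ≡ᵇ d)) else 0)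
    indicator-∧ F with isFactorization F
    ... | true  = refl
    ... | false = refl

  bit : Bool → ℕ
  bit b = if b then 1 else 0

  count : (ℕ → Bool) → List ℕ → ℕ
  count p []      = 0
  count p (z ∷ v) = bit (p z) ℕ.+ count p v

  count-++ : ∀ p xs ys → count p (xs ++ ys) ≡ count p xs ℕ.+ count p ys
  count-++ p []       ys = refl
  count-++ p (x ∷ xs) ys =
    trans (cong (bit (p x) ℕ.+_) (count-++ p xs ys)) (sym (ℕ.+-assoc (bit (p x)) _ _))

  count-reverse : ∀ p xs → count p (reverse xs) ≡ count p xs
  count-reverse p []       = refl
  count-reverse p (x ∷ xs) = begin
    count p (reverse (x ∷ xs))                        ≡⟨ cong (count p) (List.unfold-reverse x xs) ⟩
    count p (reverse xs ++ x ∷ [])                    ≡⟨ count-++ p (reverse xs) (x ∷ []) ⟩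
    count p (reverse xs) ℕ.+ count p (x ∷ [])         ≡⟨ cong₂ ℕ._+_ (count-reverse p xs) (ℕ.+-identityʳ _) ⟩
    count p xs ℕ.+ bit (p x)             ≡⟨ ℕ.+-comm (count p xs) _ ⟩
    count p (x ∷ xs)                                  ∎

  countBelow≡count : ∀ x xs → countBelow x xs ≡ count (_<ᵇ x) xs
  countBelow≡count x []       = refl
  countBelow≡count x (y ∷ xs) = cong (bit (y <ᵇ x) ℕ.+_) (countBelow≡count x xs)

  inv-∷ʳ : ∀ xs y → inv (xs ++ y ∷ []) ≡ inv xs ℕ.+ count (y <ᵇ_) xs
  inv-∷ʳ []       y = refl
  inv-∷ʳ (x ∷ xs) y = begin
    countBelow x (xs ++ y ∷ []) ℕ.+ inv (xs ++ y ∷ [])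
      ≡⟨ cong₂ ℕ._+_ (trans (countBelow≡count x (xs ++ y ∷ [])) (count-++ (_<ᵇ x) xs (y ∷ []))) (inv-∷ʳ xs y) ⟩
    (count (_<ᵇ x) xs ℕ.+ (ylt ℕ.+ 0)) ℕ.+ (inv xs ℕ.+ count (y <ᵇ_) xs)
      ≡⟨ cong (λ k → (count (_<ᵇ x) xs ℕ.+ k) ℕ.+ (inv xs ℕ.+ count (y <ᵇ_) xs)) (ℕ.+-identityʳ ylt) ⟩
    (count (_<ᵇ x) xs ℕ.+ ylt) ℕ.+ (inv xs ℕ.+ count (y <ᵇ_) xs)
      ≡⟨ CommSemigroupProperties.interchange ℕ.+-commutativeSemigroup (count (_<ᵇ x) xs) ylt (inv xs) _ ⟩
    (count (_<ᵇ x) xs ℕ.+ inv xs) ℕ.+ (ylt ℕ.+ count (y <ᵇ_) xs)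
      ≡⟨ cong (λ k → (k ℕ.+ inv xs) ℕ.+ (ylt ℕ.+ count (y <ᵇ_) xs)) (countBelow≡count x xs) ⟨
    (countBelow x xs ℕ.+ inv xs) ℕ.+ count (y <ᵇ_) (x ∷ xs)
      ∎
    where
    ylt : ℕ
    ylt = bit (y <ᵇ x)

  private
    T⇒≡true : ∀ {b} → T b → b ≡ true
    T⇒≡true {true} _ = refl

    ∧-trueˡ : ∀ {a b} → (a ∧ b) ≡ true → a ≡ true
    ∧-trueˡ {true} _ = refl

    ∧-trueʳ : ∀ {a b} → (a ∧ b) ≡ true → b ≡ true
    ∧-trueʳ {true} b≡true = b≡true

    ≤ᵇ-true⇒≤ : ∀ {m n} → (m ≤ᵇ n) ≡ true → m ≤ n
    ≤ᵇ-true⇒≤ {m} {n} m≤ᵇn = ℕ.≤ᵇ⇒≤ m n (≡.subst T (sym m≤ᵇn) _)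

  <ᵇ-false : ∀ {y x} → x ≤ y → (y <ᵇ x) ≡ false
  <ᵇ-false {y} {x} x≤y with y <ᵇ x in eq | ≤ᵇ≡not<ᵇ x y
  ... | false | _ = refl
  ... | true  | x≤ᵇy rewrite T⇒≡true (ℕ.≤⇒≤ᵇ x≤y) with () ← x≤ᵇy

  count-above-noninc : ∀ y z u → noninc (z ∷ u) ≡ true → z ≤ y → count (y <ᵇ_) (z ∷ u) ≡ 0
  count-above-noninc y z []      _  z≤y rewrite <ᵇ-false z≤y = refl
  count-above-noninc y z (v ∷ u) nu z≤y rewrite <ᵇ-false z≤y =
    count-above-noninc y v u (∧-trueʳ {v ≤ᵇ z} nu) (ℕ.≤-trans (≤ᵇ-true⇒≤ (∧-trueˡ nu)) z≤y)

  inv-reverse-noninc : ∀ u → noninc u ≡ true → inv (reverse u) ≡ 0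
  inv-reverse-noninc []          _  = refl
  inv-reverse-noninc (z ∷ [])    _  = refl
  inv-reverse-noninc (z ∷ v ∷ u) nu = begin
    inv (reverse (z ∷ v ∷ u))                                      ≡⟨ cong inv (List.unfold-reverse z (v ∷ u)) ⟩
    inv (reverse (v ∷ u) ++ z ∷ [])                                ≡⟨ inv-∷ʳ (reverse (v ∷ u)) z ⟩
    inv (reverse (v ∷ u)) ℕ.+ count (z <ᵇ_) (reverse (v ∷ u))      ≡⟨ cong₂ ℕ._+_ (inv-reverse-noninc (v ∷ u) (∧-trueʳ {v ≤ᵇ z} nu)) (count-reverse (z <ᵇ_) (v ∷ u)) ⟩
    count (z <ᵇ_) (v ∷ u)                                          ≡⟨ count-above-noninc z v u (∧-trueʳ {v ≤ᵇ z} nu) (≤ᵇ-true⇒≤ (∧-trueˡ nu)) ⟩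
    0                                                              ∎

  inv-reverse-∷ : ∀ y u → noninc u ≡ true → inv (reverse (y ∷ u)) ≡ count (y <ᵇ_) u
  inv-reverse-∷ y u nu = begin
    inv (reverse (y ∷ u))                                ≡⟨ cong inv (List.unfold-reverse y u) ⟩
    inv (reverse u ++ y ∷ [])                            ≡⟨ inv-∷ʳ (reverse u) y ⟩
    inv (reverse u) ℕ.+ count (y <ᵇ_) (reverse u)        ≡⟨ cong₂ ℕ._+_ (inv-reverse-noninc u nu) (count-reverse (y <ᵇ_) u) ⟩
    count (y <ᵇ_) u                                      ∎

  prefix-noninc : ∀ w → noninc (prefix w) ≡ true
  prefix-noninc []      = refl
  prefix-noninc (y ∷ w) = consFactorization-noninc (factorization w) (prefix-noninc w)
    where
    consFactorization-noninc : ∀ F → noninc (proj₁ F) ≡ true → noninc (proj₁ (consFactorization y F)) ≡ true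
    consFactorization-noninc ([]    , hs) _  = refl
    consFactorization-noninc (z ∷ v , hs) nv with z ≤ᵇ y in z≤ᵇy
    ... | true  = cong₂ _∧_ z≤ᵇy nv
    ... | false = refl

-- Generating series of words

infixl 6 _⊟_
_⊟_ : Ser → Ser → Ser
f ⊟ g = f ⊕ ⊖ g

sumₛ : List Ser → Ser
sumₛ []       = zeroₛ
sumₛ (f ∷ fs) = f ⊕ sumₛ fs

module _ where
  open ≡ using (refl; cong)
  open import Relation.Binary.Reasoning.Setoid SR.setoid
  import Algebra.Properties.AbelianGroup SR.+-abelianGroup as AbelianGroupProperties

  sumₛ-++ : ∀ fs gs → sumₛ (fs ++ gs) ≋ sumₛ fs ⊕ sumₛ gs
  sumₛ-++ []       gs = SR.sym (SR.+-identityˡ _)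
  sumₛ-++ (f ∷ fs) gs = SR.trans (SR.+-congˡ (sumₛ-++ fs gs)) (SR.sym (SR.+-assoc f _ _))

  sumₛ-map-cong : ∀ {A : Set} {F G : A → Ser} xs → (∀ x → F x ≋ G x) → sumₛ (map F xs) ≋ sumₛ (map G xs)
  sumₛ-map-cong []       F≋G = SR.refl
  sumₛ-map-cong (x ∷ xs) F≋G = SR.+-cong (F≋G x) (sumₛ-map-cong xs F≋G)

  sumₛ-map-concatMap : ∀ {A B : Set} (F : B → Ser) (g : A → List B) xs →
    sumₛ (map F (concatMap g xs)) ≋ sumₛ (map (λ x → sumₛ (map F (g x))) xs)
  sumₛ-map-concatMap F g []       = SR.refl
  sumₛ-map-concatMap F g (x ∷ xs) = begin
    sumₛ (map F (g x ++ concatMap g xs))                    ≡⟨ cong sumₛ (List.map-++ F (g x) _) ⟩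
    sumₛ (map F (g x) ++ map F (concatMap g xs))            ≈⟨ sumₛ-++ (map F (g x)) _ ⟩
    sumₛ (map F (g x)) ⊕ sumₛ (map F (concatMap g xs))      ≈⟨ SR.+-congˡ (sumₛ-map-concatMap F g xs) ⟩
    sumₛ (map F (g x)) ⊕ sumₛ (map (λ x → sumₛ (map F (g x))) xs) ∎

  *-distribˡ-sumₛ : ∀ {A : Set} c (F : A → Ser) xs → c ⊗ sumₛ (map F xs) ≋ sumₛ (map (λ x → c ⊗ F x) xs)
  *-distribˡ-sumₛ c F []       = SR.zeroʳ c
  *-distribˡ-sumₛ c F (x ∷ xs) = SR.trans (SR.distribˡ c _ _) (SR.+-congˡ (*-distribˡ-sumₛ c F xs))

  sumₛ-map-⊕ : ∀ {A : Set} (F G : A → Ser) xs → sumₛ (map (λ x → F x ⊕ G x) xs) ≋ sumₛ (map F xs) ⊕ sumₛ (map G xs)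
  sumₛ-map-⊕ F G []       = SR.sym (SR.+-identityˡ _)
  sumₛ-map-⊕ F G (x ∷ xs) = SR.trans (SR.+-congˡ (sumₛ-map-⊕ F G xs)) (interchange _ _ _ _)
    where open CommSemigroupProperties SR.+-commutativeSemigroup using (interchange)

  sumₛ-map-⊖ : ∀ {A : Set} (F : A → Ser) xs → sumₛ (map (λ x → ⊖ F x) xs) ≋ ⊖ sumₛ (map F xs)
  sumₛ-map-⊖ F []       = SR.sym (AbelianGroupProperties.ε⁻¹≈ε)
  sumₛ-map-⊖ F (x ∷ xs) = SR.trans (SR.+-congˡ (sumₛ-map-⊖ F xs)) (AbelianGroupProperties.⁻¹-∙-comm _ _)

  sumₛ-map-zero : ∀ {A : Set} (xs : List A) → sumₛ (map (λ _ → zeroₛ) xs) ≋ zeroₛ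
  sumₛ-map-zero []       = SR.refl
  sumₛ-map-zero (x ∷ xs) = SR.trans (SR.+-congˡ (sumₛ-map-zero xs)) (SR.+-identityˡ _)

  sumₛ-coefficient : ∀ {A : Set} a (F G : A → Ser) xs → (∀ x → F x a ≈₃ G x a) →
    sumₛ (map F xs) a ≈₃ sumₛ (map G xs) a
  sumₛ-coefficient a F G []       F≈G b c d = refl
  sumₛ-coefficient a F G (x ∷ xs) F≈G b c d =
    ≡.trans (⊕-coefficient (F x) _ a b c d)
    (≡.trans (≡.cong₂ ℤ._+_ (F≈G x b c d) (sumₛ-coefficient a F G xs F≈G b c d))
    (≡.sym (⊕-coefficient (G x) _ a b c d)))

Σ< : ℕ → (ℕ → Ser) → Ser
Σ< zero    g = zeroₛ
Σ< (suc n) g = Σ< n g ⊕ g n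

Π< : ℕ → (ℕ → Ser) → Ser
Π< zero    g = oneₛ
Π< (suc n) g = Π< n g ⊗ g n

module _ where
  open ≡ using (refl; cong)
  open import Relation.Binary.Reasoning.Setoid SR.setoid

  sumₛ-upTo : ∀ (g : ℕ → Ser) n → sumₛ (map g (upTo n)) ≋ Σ< n g
  sumₛ-upTo g zero    = SR.refl
  sumₛ-upTo g (suc n) = begin
    sumₛ (map g (upTo (suc n)))           ≡⟨ cong (λ l → sumₛ (map g l)) (≡.sym (List.upTo-∷ʳ n)) ⟩
    sumₛ (map g (upTo n ++ n ∷ []))       ≡⟨ cong sumₛ (List.map-++ g (upTo n) (n ∷ [])) ⟩
    sumₛ (map g (upTo n) ++ g n ∷ [])     ≈⟨ sumₛ-++ (map g (upTo n)) (g n ∷ []) ⟩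
    sumₛ (map g (upTo n)) ⊕ (g n ⊕ zeroₛ) ≈⟨ SR.+-cong (sumₛ-upTo g n) (SR.+-identityʳ (g n)) ⟩
    Σ< n g ⊕ g n                          ∎

  Σ<-cong : ∀ n {f g : ℕ → Ser} → (∀ i → f i ≋ g i) → Σ< n f ≋ Σ< n g
  Σ<-cong zero    f≋g = SR.refl
  Σ<-cong (suc n) f≋g = SR.+-cong (Σ<-cong n f≋g) (f≋g n)

  Σ<-cong-< : ∀ n {f g : ℕ → Ser} → (∀ i → i < n → f i ≋ g i) → Σ< n f ≋ Σ< n g
  Σ<-cong-< zero    f≋g = SR.refl
  Σ<-cong-< (suc n) f≋g = SR.+-cong (Σ<-cong-< n λ i i<n → f≋g i (ℕ.m≤n⇒m≤1+n i<n)) (f≋g n ℕ.≤-refl)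

  Π<-cong-< : ∀ n {f g : ℕ → Ser} → (∀ i → i < n → f i ≋ g i) → Π< n f ≋ Π< n g
  Π<-cong-< zero    f≋g = SR.refl
  Π<-cong-< (suc n) f≋g = SR.*-cong (Π<-cong-< n λ i i<n → f≋g i (ℕ.m≤n⇒m≤1+n i<n)) (f≋g n ℕ.≤-refl)

  <ᵇ-true : ∀ {y x} → y < x → (y <ᵇ x) ≡ true
  <ᵇ-true {y} {x} y<x with y <ᵇ x | ℕ.<⇒<ᵇ y<x
  ... | true | _ = refl

  Σ<-restrict : ∀ (g : ℕ → Ser) n x → x ≤ n → Σ< n (λ y → if y <ᵇ x then g y else zeroₛ) ≋ Σ< x g
  Σ<-restrict g zero    .zero z≤n = SR.refl
  Σ<-restrict g (suc n) x     x≤1+n with ℕ.m≤n⇒m<n∨m≡n x≤1+n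
  ... | inj₂ refl = SR.+-cong
    (Σ<-cong-< n λ i i<n → SR.reflexive (cong (λ b → if b then g i else zeroₛ) (<ᵇ-true (ℕ.m≤n⇒m≤1+n i<n))))
    (SR.reflexive (cong (λ b → if b then g n else zeroₛ) (<ᵇ-true (ℕ.n<1+n n))))
  ... | inj₁ x<1+n = SR.trans
    (SR.+-cong (Σ<-restrict g n x (ℕ.≤-pred x<1+n))
               (SR.reflexive (cong (λ b → if b then g n else zeroₛ) (<ᵇ-false (ℕ.≤-pred x<1+n)))))
    (SR.+-identityʳ _)

module Words (r : ℕ) where
  open ≡ using (refl; cong)
  open import Relation.Binary.Reasoning.Setoid SR.setoid

  letters : List ℕ
  letters = upTo (suc r)

  -- Σ_{w ∈ W(r)} F w for F w homogeneous of u-degree |w|: degree n is read off the words of length n.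
  series : (List ℕ → Ser) → Ser
  series F n = sumₛ (map F (words r n)) n

  series-⊕ : ∀ F G → series (λ w → F w ⊕ G w) ≋ series F ⊕ series G
  series-⊕ F G = mk≋ λ n b c d →
    ≡.trans (get (sumₛ-map-⊕ F G (words r n)) n b c d)
    (≡.trans (⊕-coefficient (sumₛ (map F (words r n))) _ n b c d)
    (≡.sym (⊕-coefficient (series F) (series G) n b c d)))

  series-⊖ : ∀ F → series (λ w → ⊖ F w) ≋ ⊖ series F
  series-⊖ F = mk≋ λ n b c d →
    ≡.trans (get (sumₛ-map-⊖ F (words r n)) n b c d)
    (≡.trans (⊖-coefficient (sumₛ (map F (words r n))) n b c d)
    (≡.sym (⊖-coefficient (series F) n b c d)))

  series-zero : series (λ _ → zeroₛ) ≋ zeroₛ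
  series-zero = mk≋ λ n → get (sumₛ-map-zero (words r n)) n

  series-FreeOfU : ∀ k → FreeOfU k → ∀ F → series (λ w → k ⊗ F w) ≋ k ⊗ series F
  series-FreeOfU k k-free F = mk≋ λ n →
    trans₃ (sym₃ (get (*-distribˡ-sumₛ k F (words r n)) n))
    (trans₃ (FreeOfU-⊗ k k-free (sumₛ (map F (words r n))) n)
    (sym₃ (FreeOfU-⊗ k k-free (series F) n)))

  series-first-letter : ∀ F (K : ℕ → List ℕ → Ser) → F [] ≋ oneₛ → (∀ y w → F (y ∷ w) ≋ U ⊗ K y w) →
    series F ≋ oneₛ ⊕ U ⊗ sumₛ (map (λ y → series (K y)) letters)
  series-first-letter F K F[]≋1 F∷≋UK = mk≋ coefficient
    where
    S : Ser
    S = sumₛ (map (λ y → series (K y)) letters)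

    words-suc : ∀ n → sumₛ (map F (words r (suc n))) ≋ U ⊗ sumₛ (map (λ y → sumₛ (map (K y) (words r n))) letters)
    words-suc n = begin
      sumₛ (map F (concatMap (λ x → map (x ∷_) ws) letters))
        ≈⟨ sumₛ-map-concatMap F (λ x → map (x ∷_) ws) letters ⟩
      sumₛ (map (λ y → sumₛ (map F (map (y ∷_) ws))) letters)
        ≈⟨ sumₛ-map-cong letters (λ y → SR.reflexive (cong sumₛ (≡.sym (List.map-∘ ws)))) ⟩
      sumₛ (map (λ y → sumₛ (map (λ w → F (y ∷ w)) ws)) letters)
        ≈⟨ sumₛ-map-cong letters (λ y → sumₛ-map-cong ws (F∷≋UK y)) ⟩
      sumₛ (map (λ y → sumₛ (map (λ w → U ⊗ K y w) ws)) letters)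
        ≈⟨ sumₛ-map-cong letters (λ y → *-distribˡ-sumₛ U (K y) ws) ⟨
      sumₛ (map (λ y → U ⊗ sumₛ (map (K y) ws)) letters)
        ≈⟨ *-distribˡ-sumₛ U _ letters ⟨
      U ⊗ sumₛ (map (λ y → sumₛ (map (K y) ws)) letters)
        ∎
      where
      ws = words r n

    coefficient : ∀ a b c d → series F a b c d ≡ (oneₛ ⊕ U ⊗ S) a b c d
    coefficient zero b c d =
      ≡.trans (⊕-coefficient (F []) zeroₛ 0 b c d)
      (≡.trans (≡.cong₂ ℤ._+_ (get F[]≋1 0 b c d) (≡.sym (U-⊗-zero S b c d)))
      (≡.sym (⊕-coefficient oneₛ (U ⊗ S) 0 b c d)))
    coefficient (suc n) b c d =
      ≡.trans (get (words-suc n) (suc n) b c d)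
      (≡.trans (U-⊗-suc _ n b c d)
      (≡.trans (sumₛ-coefficient n _ (λ y → series (K y)) letters (λ _ _ _ _ → refl) b c d)
      (≡.trans (≡.sym (ℤ.+-identityˡ _))
      (≡.trans (cong (ℤ._+_ 0ℤ) (≡.sym (U-⊗-suc S n b c d)))
      (≡.sym (⊕-coefficient oneₛ (U ⊗ S) (suc n) b c d))))))

below : Maybe ℕ → ℕ → Bool
below nothing  _ = true
below (just x) y = y <ᵇ x

headBelow : Maybe ℕ → List ℕ → Bool
headBelow x []      = true
headBelow x (z ∷ _) = below x z

atLeast : ℕ → ℕ → Bool
atLeast t z = t ≤ᵇ z

Q : ℕ → Ser
Q y = mono 0 0 y 0

prefixLetter : (ℕ → Bool) → ℕ → ℕ → Ser
prefixLetter mark e y = mono 0 (bit (mark y)) y e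

weightᶠ : (ℕ → Bool) → ℕ → Maybe ℕ → ℕ → ℕ → Factorization → Ser
weightᶠ mark e x n t F =
  if headBelow x (proj₁ F) then mono n (wlecF F ℕ.+ count mark (proj₁ F)) t (e ℕ.* length (proj₁ F)) else zeroₛ

weight : (ℕ → Bool) → ℕ → Maybe ℕ → List ℕ → Ser
weight mark e x w = weightᶠ mark e x (length w) (tot w) (factorization w)

-- Prepending y either closes the prefix u into an H-word (when u starts above y; the
-- difference of the first two weights selects exactly that case) or extends u.
weightAfterᶠ : (ℕ → Bool) → ℕ → Maybe ℕ → ℕ → ℕ → ℕ → Factorization → Ser
weightAfterᶠ mark e x y n t F =
  Q y ⊗ (weightᶠ (atLeast (suc y)) 0 nothing n t F ⊟ weightᶠ (atLeast (suc y)) 0 (just (suc y)) n t F)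
  ⊕ (if below x y then prefixLetter mark e y ⊗ weightᶠ mark e (just (suc y)) n t F else zeroₛ)

weightAfter : (ℕ → Bool) → ℕ → Maybe ℕ → ℕ → List ℕ → Ser
weightAfter mark e x y w = weightAfterᶠ mark e x y (length w) (tot w) (factorization w)

module _ where
  open ≡ using (refl; cong)
  open import Relation.Binary.Reasoning.Setoid SR.setoid

  U-prefixLetter-mono : ∀ mark e y n L t c k →
    U ⊗ (prefixLetter mark e y ⊗ mono n (L ℕ.+ c) t (e ℕ.* k)) ≋
    mono (suc n) (L ℕ.+ (bit (mark y) ℕ.+ c)) (y ℕ.+ t) (e ℕ.* suc k)
  U-prefixLetter-mono mark e y n L t c k = begin
    U ⊗ (prefixLetter mark e y ⊗ mono n (L ℕ.+ c) t (e ℕ.* k))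
      ≈⟨ SR.*-assoc U (prefixLetter mark e y) _ ⟨
    (U ⊗ prefixLetter mark e y) ⊗ mono n (L ℕ.+ c) t (e ℕ.* k)
      ≈⟨ SR.*-congʳ (mono-⊗-mono 1 0 0 0 0 (bit (mark y)) y e) ⟩
    mono 1 (bit (mark y)) y e ⊗ mono n (L ℕ.+ c) t (e ℕ.* k)
      ≈⟨ mono-⊗-mono 1 (bit (mark y)) y e n (L ℕ.+ c) t (e ℕ.* k) ⟩
    mono (suc n) (bit (mark y) ℕ.+ (L ℕ.+ c)) (y ℕ.+ t) (e ℕ.+ e ℕ.* k)
      ≈⟨ mono-cong (suc n) (y ℕ.+ t) (x+[y+z]≡y+[x+z] (bit (mark y)) L c) (≡.sym (ℕ.*-suc e k)) ⟩
    mono (suc n) (L ℕ.+ (bit (mark y) ℕ.+ c)) (y ℕ.+ t) (e ℕ.* suc k)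
      ∎
    where
    x+[y+z]≡y+[x+z] : ∀ x y z → x ℕ.+ (y ℕ.+ z) ≡ y ℕ.+ (x ℕ.+ z)
    x+[y+z]≡y+[x+z] x y z = ≡.trans (≡.sym (ℕ.+-assoc x y z)) (≡.trans (cong (ℕ._+ z) (ℕ.+-comm x y)) (ℕ.+-assoc y x z))

  U-Q-mono : ∀ y n L t v e I → I ≡ count (y <ᵇ_) v →
    (U ⊗ Q y) ⊗ mono n (L ℕ.+ count (atLeast (suc y)) v) t 0 ≋ mono (suc n) ((I ℕ.+ L) ℕ.+ 0) (y ℕ.+ t) (e ℕ.* 0)
  U-Q-mono y n L t v e I I≡count = begin
    (U ⊗ Q y) ⊗ mono n (L ℕ.+ count (atLeast (suc y)) v) t 0
      ≈⟨ SR.*-congʳ (mono-⊗-mono 1 0 0 0 0 0 y 0) ⟩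
    mono 1 0 y 0 ⊗ mono n (L ℕ.+ count (atLeast (suc y)) v) t 0
      ≈⟨ mono-⊗-mono 1 0 y 0 n (L ℕ.+ count (atLeast (suc y)) v) t 0 ⟩
    mono (suc n) (L ℕ.+ count (atLeast (suc y)) v) (y ℕ.+ t) 0
      ≈⟨ mono-cong (suc n) (y ℕ.+ t)
           (≡.trans (≡.trans (ℕ.+-comm L _) (cong (ℕ._+ L) (≡.sym I≡count))) (≡.sym (ℕ.+-identityʳ _)))
           (≡.sym (ℕ.*-zeroʳ e)) ⟩
    mono (suc n) ((I ℕ.+ L) ℕ.+ 0) (y ℕ.+ t) (e ℕ.* 0)
      ∎

  private
    extend : ∀ u q m M m′ → u ⊗ (q ⊗ (m ⊟ m) ⊕ M ⊗ m′) ≋ (u ⊗ M) ⊗ m′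
    extend = solve 5 (λ u q m M m′ → u :* (q :* (m :- m) :+ M :* m′) := (u :* M) :* m′) SR.refl

    extend-out-of-bound : ∀ u q m → u ⊗ (q ⊗ (m ⊟ m) ⊕ zeroₛ) ≋ zeroₛ
    extend-out-of-bound = solve 3 (λ u q m → u :* (q :* (m :- m) :+ con (ℤ.+ 0)) := con (ℤ.+ 0)) SR.refl

    close : ∀ u q m M → u ⊗ (q ⊗ (m ⊟ zeroₛ) ⊕ M ⊗ zeroₛ) ≋ (u ⊗ q) ⊗ m
    close = solve 4 (λ u q m M → u :* (q :* (m :- con (ℤ.+ 0)) :+ M :* con (ℤ.+ 0)) := (u :* q) :* m) SR.refl

    close-out-of-bound : ∀ u q m → u ⊗ (q ⊗ (m ⊟ zeroₛ) ⊕ zeroₛ) ≋ (u ⊗ q) ⊗ m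
    close-out-of-bound = solve 3 (λ u q m → u :* (q :* (m :- con (ℤ.+ 0)) :+ con (ℤ.+ 0)) := (u :* q) :* m) SR.refl

  weightᶠ-consFactorization : ∀ mark e x y n t F → noninc (proj₁ F) ≡ true →
    weightᶠ mark e x (suc n) (y ℕ.+ t) (consFactorization y F) ≋ U ⊗ weightAfterᶠ mark e x y n t F
  weightᶠ-consFactorization mark e x y n t ([] , hs) _ with below x y
  ... | true  = SR.sym (SR.trans (extend U (Q y) _ (prefixLetter mark e y) _)
                  (SR.trans (SR.*-assoc U (prefixLetter mark e y) _) (U-prefixLetter-mono mark e y n (wlecF ([] , hs)) t 0 0)))
  ... | false = SR.sym (extend-out-of-bound U (Q y) _)
  weightᶠ-consFactorization mark e x y n t (z ∷ v , hs) nv rewrite <ᵇ-suc z y with z ≤ᵇ y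
  ... | true with below x y
  ...   | true  = SR.sym (SR.trans (extend U (Q y) _ (prefixLetter mark e y) _)
                    (SR.trans (SR.*-assoc U (prefixLetter mark e y) _)
                      (U-prefixLetter-mono mark e y n (wlecF ([] , hs)) t (count mark (z ∷ v)) (suc (length v)))))
  ...   | false = SR.sym (extend-out-of-bound U (Q y) _)
  weightᶠ-consFactorization mark e x y n t (z ∷ v , hs) nv | false with below x y
  ...   | true  = SR.sym (SR.trans (close U (Q y) _ (prefixLetter mark e y))
                    (U-Q-mono y n (wlecF ([] , hs)) t (z ∷ v) e _ (inv-reverse-∷ y (z ∷ v) nv)))
  ...   | false = SR.sym (SR.trans (close-out-of-bound U (Q y) _)
                    (U-Q-mono y n (wlecF ([] , hs)) t (z ∷ v) e _ (inv-reverse-∷ y (z ∷ v) nv)))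

factor : (ℕ → Bool) → ℕ → ℕ → Ser
factor mark e y = oneₛ ⊟ U ⊗ prefixLetter mark e y

weight-[] : ∀ mark e x → weight mark e x [] ≋ oneₛ
weight-[] mark e x = mono-cong 0 {0} 0 ≡.refl (ℕ.*-zeroʳ e)

weight-∷ : ∀ mark e x y w → weight mark e x (y ∷ w) ≋ U ⊗ weightAfter mark e x y w
weight-∷ mark e x y w =
  weightᶠ-consFactorization mark e x y (length w) (tot w) (factorization w) (prefix-noninc w)

-- G mark e x: generating series of W(r) for the weight above; E: words with empty prefix u;
-- Z t: prefix letters ≥ t marked and the first one below t.
module GeneratingSeries (r : ℕ) where
  open Words r public
  open import Relation.Binary.Reasoning.Setoid SR.setoid

  G : (ℕ → Bool) → ℕ → Maybe ℕ → Ser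
  G mark e x = series (weight mark e x)

  E : Ser
  E = G (λ _ → false) 0 (just 0)

  Z : ℕ → Ser
  Z t = G (atLeast t) 0 (just t)

  closing : ℕ → Ser
  closing y = Q y ⊗ (G (atLeast (suc y)) 0 nothing ⊟ Z (suc y))

  extending : (ℕ → Bool) → ℕ → Maybe ℕ → ℕ → Ser
  extending mark e x y = if below x y then prefixLetter mark e y ⊗ G mark e (just (suc y)) else zeroₛ

  series-weightAfter : ∀ mark e x y → series (weightAfter mark e x y) ≋ closing y ⊕ extending mark e x y
  series-weightAfter mark e x y = SR.trans (series-⊕ _ _) (SR.+-cong closing≋ extending≋)
    where
    closing≋ : series (λ w → Q y ⊗ (weight (atLeast (suc y)) 0 nothing w ⊟ weight (atLeast (suc y)) 0 (just (suc y)) w))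
               ≋ closing y
    closing≋ = SR.trans (series-FreeOfU (Q y) (mono-FreeOfU 0 y 0) _)
                        (SR.*-congˡ (SR.trans (series-⊕ _ _) (SR.+-congˡ (series-⊖ _))))

    extending≋ : series (λ w → if below x y then prefixLetter mark e y ⊗ weight mark e (just (suc y)) w else zeroₛ)
                 ≋ extending mark e x y
    extending≋ with below x y
    ... | true  = series-FreeOfU (prefixLetter mark e y) (mono-FreeOfU (bit (mark y)) y e) _
    ... | false = series-zero

  G-first-letter : ∀ mark e x → G mark e x ≋ oneₛ ⊕ U ⊗ sumₛ (map (λ y → closing y ⊕ extending mark e x y) letters)
  G-first-letter mark e x =
    SR.trans (series-first-letter (weight mark e x) (weightAfter mark e x) (weight-[] mark e x) (weight-∷ mark e x))
             (SR.+-congˡ (SR.*-congˡ (sumₛ-map-cong letters (series-weightAfter mark e x))))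

  E-first-letter : E ≋ oneₛ ⊕ U ⊗ sumₛ (map closing letters)
  E-first-letter = SR.trans (G-first-letter (λ _ → false) 0 (just 0))
    (SR.+-congˡ (SR.*-congˡ (sumₛ-map-cong letters λ y → SR.+-identityʳ (closing y))))

  G≋E⊕extending : ∀ mark e x → G mark e x ≋ E ⊕ U ⊗ sumₛ (map (extending mark e x) letters)
  G≋E⊕extending mark e x = begin
    G mark e x
      ≈⟨ G-first-letter mark e x ⟩
    oneₛ ⊕ U ⊗ sumₛ (map (λ y → closing y ⊕ extending mark e x y) letters)
      ≈⟨ SR.+-congˡ (SR.*-congˡ (sumₛ-map-⊕ closing (extending mark e x) letters)) ⟩
    oneₛ ⊕ U ⊗ (sumₛ (map closing letters) ⊕ sumₛ (map (extending mark e x) letters))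
      ≈⟨ regroup oneₛ U _ _ ⟩
    (oneₛ ⊕ U ⊗ sumₛ (map closing letters)) ⊕ U ⊗ sumₛ (map (extending mark e x) letters)
      ≈⟨ SR.+-congʳ E-first-letter ⟨
    E ⊕ U ⊗ sumₛ (map (extending mark e x) letters)
      ∎
    where
    regroup : ∀ o u a b → o ⊕ u ⊗ (a ⊕ b) ≋ (o ⊕ u ⊗ a) ⊕ u ⊗ b
    regroup = solve 4 (λ o u a b → o :+ u :* (a :+ b) := (o :+ u :* a) :+ u :* b) SR.refl

  extended : (ℕ → Bool) → ℕ → ℕ → Ser
  extended mark e y = prefixLetter mark e y ⊗ G mark e (just (suc y))

  G-bounded : ∀ mark e x → x ≤ suc r → G mark e (just x) ≋ E ⊕ U ⊗ Σ< x (extended mark e)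
  G-bounded mark e x x≤ = SR.trans (G≋E⊕extending mark e (just x))
    (SR.+-congˡ (SR.*-congˡ (SR.trans (sumₛ-upTo _ (suc r)) (Σ<-restrict (extended mark e) (suc r) x x≤))))

  G-unbounded : ∀ mark e → G mark e nothing ≋ G mark e (just (suc r))
  G-unbounded mark e = SR.trans (G≋E⊕extending mark e nothing)
    (SR.trans (SR.+-congˡ (SR.*-congˡ (sumₛ-upTo _ (suc r)))) (SR.sym (G-bounded mark e (suc r) ℕ.≤-refl)))

  G-bound-zero : ∀ mark e → G mark e (just 0) ≋ E
  G-bound-zero mark e = SR.trans (G-bounded mark e 0 z≤n) (SR.trans (SR.+-congˡ (SR.zeroʳ U)) (SR.+-identityʳ E))

  factor-G-bound-suc : ∀ mark e x → x ≤ r → factor mark e x ⊗ G mark e (just (suc x)) ≋ G mark e (just x)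
  factor-G-bound-suc mark e x x≤r = begin
    factor mark e x ⊗ G mark e (just (suc x))
      ≈⟨ SR.*-congˡ (G-bounded mark e (suc x) (s≤s x≤r)) ⟩
    factor mark e x ⊗ (E ⊕ U ⊗ (S ⊕ m ⊗ g))
      ≈⟨ expand E U S m g ⟩
    (E ⊕ U ⊗ S) ⊕ U ⊗ (m ⊗ (g ⊟ (E ⊕ U ⊗ (S ⊕ m ⊗ g))))
      ≈⟨ SR.+-cong (SR.sym (G-bounded mark e x (ℕ.m≤n⇒m≤1+n x≤r)))
                   (SR.*-congˡ (SR.*-congˡ (SR.+-congˡ (SR.-‿cong (SR.sym (G-bounded mark e (suc x) (s≤s x≤r))))))) ⟩
    G mark e (just x) ⊕ U ⊗ (m ⊗ (g ⊟ g))
      ≈⟨ cancel (G mark e (just x)) U m g ⟩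
    G mark e (just x)
      ∎
    where
    S m g : Ser
    S = Σ< x (extended mark e)
    m = prefixLetter mark e x
    g = G mark e (just (suc x))

    expand : ∀ E u S m g → (oneₛ ⊟ u ⊗ m) ⊗ (E ⊕ u ⊗ (S ⊕ m ⊗ g)) ≋ (E ⊕ u ⊗ S) ⊕ u ⊗ (m ⊗ (g ⊟ (E ⊕ u ⊗ (S ⊕ m ⊗ g))))
    expand = solve 5 (λ E u S m g → (con (ℤ.+ 1) :- u :* m) :* (E :+ u :* (S :+ m :* g)) :=
                                    (E :+ u :* S) :+ u :* (m :* (g :- (E :+ u :* (S :+ m :* g))))) SR.refl

    cancel : ∀ a u m g → a ⊕ u ⊗ (m ⊗ (g ⊟ g)) ≋ a
    cancel = solve 4 (λ a u m g → a :+ u :* (m :* (g :- g)) := a) SR.refl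

  Π<-factor-G : ∀ mark e x → x ≤ suc r → Π< x (factor mark e) ⊗ G mark e (just x) ≋ E
  Π<-factor-G mark e zero    _   = SR.trans (SR.*-identityˡ _) (G-bound-zero mark e)
  Π<-factor-G mark e (suc x) x<  = begin
    (Π< x (factor mark e) ⊗ factor mark e x) ⊗ G mark e (just (suc x)) ≈⟨ SR.*-assoc _ _ _ ⟩
    Π< x (factor mark e) ⊗ (factor mark e x ⊗ G mark e (just (suc x))) ≈⟨ SR.*-congˡ (factor-G-bound-suc mark e x (ℕ.≤-pred x<)) ⟩
    Π< x (factor mark e) ⊗ G mark e (just x)                           ≈⟨ Π<-factor-G mark e x (ℕ.m≤n⇒m≤1+n (ℕ.≤-pred x<)) ⟩
    E                                                                  ∎

-- Cancellation, telescoping and reindexing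

module _ where
  open ≡ using (refl; cong)
  open import Relation.Binary.Reasoning.Setoid SR.setoid

  -- (1 - uM) h = 0 gives h = u M h, which forces the coefficients of h to vanish degree by degree.
  1-UM-cancel : ∀ M → FreeOfU M → ∀ f g → (oneₛ ⊟ U ⊗ M) ⊗ f ≋ (oneₛ ⊟ U ⊗ M) ⊗ g → f ≋ g
  1-UM-cancel M M-free f g eq = begin
    f                 ≈⟨ split f g ⟩
    (f ⊟ g) ⊕ g       ≈⟨ SR.+-congʳ (mk≋ (λ a → vanishes a)) ⟩
    zeroₛ ⊕ g         ≈⟨ SR.+-identityˡ g ⟩
    g                 ∎
    where
    h : Ser
    h = f ⊟ g

    split : ∀ f g → f ≋ (f ⊟ g) ⊕ g
    split = solve 2 (λ f g → f := (f :- g) :+ g) SR.refl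

    h≋UMh : h ≋ U ⊗ (M ⊗ h)
    h≋UMh = begin
      h                                                        ≈⟨ rearrange U M f g ⟩
      U ⊗ (M ⊗ h) ⊕ ((oneₛ ⊟ U ⊗ M) ⊗ f ⊟ (oneₛ ⊟ U ⊗ M) ⊗ g)  ≈⟨ SR.+-congˡ (SR.+-congʳ eq) ⟩
      U ⊗ (M ⊗ h) ⊕ ((oneₛ ⊟ U ⊗ M) ⊗ g ⊟ (oneₛ ⊟ U ⊗ M) ⊗ g)  ≈⟨ SR.+-congˡ (SR.-‿inverseʳ _) ⟩
      U ⊗ (M ⊗ h) ⊕ zeroₛ                                      ≈⟨ SR.+-identityʳ _ ⟩
      U ⊗ (M ⊗ h)                                              ∎
      where
      rearrange : ∀ u m f g → f ⊟ g ≋ u ⊗ (m ⊗ (f ⊟ g)) ⊕ ((oneₛ ⊟ u ⊗ m) ⊗ f ⊟ (oneₛ ⊟ u ⊗ m) ⊗ g)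
      rearrange = solve 4 (λ u m f g → f :- g :=
        u :* (m :* (f :- g)) :+ ((con (ℤ.+ 1) :- u :* m) :* f :- (con (ℤ.+ 1) :- u :* m) :* g)) SR.refl

    vanishes : ∀ a → h a ≈₃ S₃.0ᴾ
    vanishes zero    = trans₃ (get h≋UMh 0) (U-⊗-zero (M ⊗ h))
    vanishes (suc n) =
      trans₃ (get h≋UMh (suc n))
      (trans₃ (U-⊗-suc (M ⊗ h) n)
      (trans₃ (FreeOfU-⊗ M M-free h n)
      (trans₃ {g = M 0 S₃.*ᴾ S₃.0ᴾ} (S₃.*ᴾ-congˡ (M 0) (vanishes n))
      (CommutativeRing.zeroʳ S₃.commutativeRing (M 0)))))

  Π<-1-UM-cancel : ∀ n (M : ℕ → Ser) → (∀ m → FreeOfU (M m)) → ∀ f g →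
    Π< n (λ m → oneₛ ⊟ U ⊗ M m) ⊗ f ≋ Π< n (λ m → oneₛ ⊟ U ⊗ M m) ⊗ g → f ≋ g
  Π<-1-UM-cancel zero    M M-free f g eq = SR.trans (SR.sym (SR.*-identityˡ f)) (SR.trans eq (SR.*-identityˡ g))
  Π<-1-UM-cancel (suc n) M M-free f g eq = 1-UM-cancel (M n) (M-free n) f g
    (Π<-1-UM-cancel n M M-free _ _ (SR.trans (SR.sym (SR.*-assoc _ _ f)) (SR.trans eq (SR.*-assoc _ _ g))))

  Σ<-telescope : ∀ (X : ℕ → Ser) n → Σ< n (λ y → X (suc y) ⊟ X y) ≋ X n ⊟ X 0
  Σ<-telescope X zero    = SR.sym (SR.-‿inverseʳ (X 0))
  Σ<-telescope X (suc n) = SR.trans (SR.+-congʳ (Σ<-telescope X n)) (collapse (X (suc n)) (X n) (X 0))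
    where
    collapse : ∀ a b c → (b ⊟ c) ⊕ (a ⊟ b) ≋ a ⊟ c
    collapse = solve 3 (λ a b c → (b :- c) :+ (a :- b) := a :- c) SR.refl

  Σ<-suc : ∀ n (g : ℕ → Ser) → Σ< (suc n) g ≋ g 0 ⊕ Σ< n (λ y → g (suc y))
  Σ<-suc zero    g = SR.trans (SR.+-identityˡ (g 0)) (SR.sym (SR.+-identityʳ (g 0)))
  Σ<-suc (suc n) g = SR.trans (SR.+-congʳ (Σ<-suc n g)) (SR.+-assoc _ _ _)

  Σ<-⊟ : ∀ n (f g : ℕ → Ser) → Σ< n (λ y → f y ⊟ g y) ≋ Σ< n f ⊟ Σ< n g
  Σ<-⊟ zero    f g = solve 0 (con (ℤ.+ 0) := con (ℤ.+ 0) :- con (ℤ.+ 0)) SR.refl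
  Σ<-⊟ (suc n) f g = SR.trans (SR.+-congʳ (Σ<-⊟ n f g)) (regroup _ _ _ _)
    where
    regroup : ∀ a b c d → (a ⊟ b) ⊕ (c ⊟ d) ≋ (a ⊕ c) ⊟ (b ⊕ d)
    regroup = solve 4 (λ a b c d → (a :- b) :+ (c :- d) := (a :+ c) :- (b :+ d)) SR.refl

  *-distribˡ-Σ< : ∀ n c (f : ℕ → Ser) → c ⊗ Σ< n f ≋ Σ< n (λ y → c ⊗ f y)
  *-distribˡ-Σ< zero    c f = SR.zeroʳ c
  *-distribˡ-Σ< (suc n) c f = SR.trans (SR.distribˡ c _ _) (SR.+-congʳ (*-distribˡ-Σ< n c f))

  Π<-suc : ∀ n (g : ℕ → Ser) → Π< (suc n) g ≋ g 0 ⊗ Π< n (λ y → g (suc y))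
  Π<-suc zero    g = SR.trans (SR.*-identityˡ (g 0)) (SR.sym (SR.*-identityʳ (g 0)))
  Π<-suc (suc n) g = SR.trans (SR.*-congʳ (Π<-suc n g)) (SR.*-assoc _ _ _)

  Π<-exchange : ∀ (f g : ℕ → Ser) y → (∀ m → (m ≡ y → ⊥) → f m ≋ g m) →
    ∀ n → y < n → Π< n f ⊗ g y ≋ Π< n g ⊗ f y
  Π<-exchange f g y f≋g = go
    where
    swap : ∀ p p′ a b → p ≋ p′ → (p ⊗ a) ⊗ b ≋ (p′ ⊗ b) ⊗ a
    swap p p′ a b p≋p′ = SR.trans (SR.*-congʳ (SR.*-congʳ p≋p′))
      (solve 3 (λ p a b → (p :* a) :* b := (p :* b) :* a) SR.refl p′ a b)

    go : ∀ n → y < n → Π< n f ⊗ g y ≋ Π< n g ⊗ f y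
    go (suc n) (s≤s y≤n) with ℕ.m≤n⇒m<n∨m≡n y≤n
    ... | inj₂ refl = swap (Π< n f) (Π< n g) (f n) (g n)
                        (Π<-cong-< n λ i i<n → f≋g i λ i≡n → ℕ.<-irrefl i≡n i<n)
    ... | inj₁ y<n  = begin
      (Π< n f ⊗ f n) ⊗ g y   ≈⟨ swap (Π< n f) (Π< n f) (f n) (g y) SR.refl ⟩
      (Π< n f ⊗ g y) ⊗ f n   ≈⟨ SR.*-cong (go n y<n) (f≋g n λ n≡y → ℕ.<-irrefl (≡.sym n≡y) y<n) ⟩
      (Π< n g ⊗ f y) ⊗ g n   ≈⟨ swap (Π< n g) (Π< n g) (f y) (g n) SR.refl ⟩
      (Π< n g ⊗ g n) ⊗ f y   ∎

-- The identity for E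

pochhammer : Ser → ℕ → Ser
pochhammer x n = Π< n (λ m → oneₛ ⊟ x ⊗ Q m)

SQ^ : ℕ → Ser
SQ^ y = mono 0 1 y 0

module _ where
  open ≡ using (refl; cong)

  factor-atLeast-< : ∀ {t y} → y < t → factor (atLeast t) 0 y ≡ oneₛ ⊟ U ⊗ Q y
  factor-atLeast-< {t} {y} y<t = cong (λ b → oneₛ ⊟ U ⊗ mono 0 (bit b) y 0)
    (≡.trans (≤ᵇ≡not<ᵇ t y) (cong not (<ᵇ-true y<t)))

  factor-atLeast-≥ : ∀ {t y} → t ≤ y → factor (atLeast t) 0 y ≡ oneₛ ⊟ U ⊗ SQ^ y
  factor-atLeast-≥ {t} {y} t≤y with t ≤ᵇ y | ℕ.≤⇒≤ᵇ t≤y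
  ... | true | _ = refl

  factor-atLeast-≢ : ∀ {y m} → (m ≡ y → ⊥) → factor (atLeast (suc y)) 0 m ≡ factor (atLeast y) 0 m
  factor-atLeast-≢ {y} {m} m≢y with ℕ.<-cmp m y
  ... | tri< m<y _ _ = ≡.trans (factor-atLeast-< (ℕ.m≤n⇒m≤1+n m<y)) (≡.sym (factor-atLeast-< m<y))
  ... | tri≈ _ m≡y _ = ⊥-elim (m≢y m≡y)
  ... | tri> _ _ y<m = ≡.trans (factor-atLeast-≥ y<m) (≡.sym (factor-atLeast-≥ (ℕ.<⇒≤ y<m)))

module IdentityForE (r : ℕ) where
  open GeneratingSeries r
  open ≡ using (refl; cong)
  open import Relation.Binary.Reasoning.Setoid SR.setoid

  α β : ℕ → Ser
  α y = U ⊗ Q y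
  β y = U ⊗ SQ^ y

  -- Π<-factor-G gives (u;q)_t · Z t = E and P t · D t = E, i.e. D t is E divided by
  -- Π_{m ≤ r} (1 - u s^[t ≤ m] q^m); the sums below telescope over t.
  D : ℕ → Ser
  D t = G (atLeast t) 0 (just (suc r))

  P : ℕ → Ser
  P t = Π< (suc r) (factor (atLeast t) 0)

  pochhammer-cancel : ∀ n f g → pochhammer U n ⊗ f ≋ pochhammer U n ⊗ g → f ≋ g
  pochhammer-cancel n = Π<-1-UM-cancel n Q (λ m → mono-FreeOfU 0 m 0)

  P-cancel : ∀ t f g → P t ⊗ f ≋ P t ⊗ g → f ≋ g
  P-cancel t = Π<-1-UM-cancel (suc r) (prefixLetter (atLeast t) 0) (λ m → mono-FreeOfU (bit (atLeast t m)) m 0)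

  pochhammer-Z : ∀ t → t ≤ suc r → pochhammer U t ⊗ Z t ≋ E
  pochhammer-Z t t≤ = SR.trans
    (SR.*-congʳ (Π<-cong-< t λ m m<t → SR.reflexive (≡.sym (factor-atLeast-< m<t))))
    (Π<-factor-G (atLeast t) 0 t t≤)

  Z-step : ∀ y → y ≤ r → (oneₛ ⊟ α y) ⊗ Z (suc y) ≋ Z y
  Z-step y y≤r = pochhammer-cancel y _ _ (begin
    pochhammer U y ⊗ ((oneₛ ⊟ α y) ⊗ Z (suc y)) ≈⟨ SR.*-assoc _ _ _ ⟨
    pochhammer U (suc y) ⊗ Z (suc y)            ≈⟨ pochhammer-Z (suc y) (s≤s y≤r) ⟩
    E                                           ≈⟨ pochhammer-Z y (ℕ.m≤n⇒m≤1+n y≤r) ⟨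
    pochhammer U y ⊗ Z y                        ∎)

  D-step : ∀ y → y ≤ r → (oneₛ ⊟ α y) ⊗ D (suc y) ≋ (oneₛ ⊟ β y) ⊗ D y
  D-step y y≤r = P-cancel y _ _ (begin
    P y ⊗ ((oneₛ ⊟ α y) ⊗ D (suc y))  ≈⟨ SR.*-assoc _ _ _ ⟨
    (P y ⊗ (oneₛ ⊟ α y)) ⊗ D (suc y)  ≈⟨ SR.*-congʳ exchange ⟨
    (P (suc y) ⊗ (oneₛ ⊟ β y)) ⊗ D (suc y) ≈⟨ pull _ _ _ ⟩
    (oneₛ ⊟ β y) ⊗ (P (suc y) ⊗ D (suc y)) ≈⟨ SR.*-congˡ (Π<-factor-G (atLeast (suc y)) 0 (suc r) ℕ.≤-refl) ⟩
    (oneₛ ⊟ β y) ⊗ E                   ≈⟨ SR.*-congˡ (Π<-factor-G (atLeast y) 0 (suc r) ℕ.≤-refl) ⟨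
    (oneₛ ⊟ β y) ⊗ (P y ⊗ D y)         ≈⟨ pull _ _ _ ⟨
    (P y ⊗ (oneₛ ⊟ β y)) ⊗ D y         ≈⟨ SR.*-assoc _ _ _ ⟩
    P y ⊗ ((oneₛ ⊟ β y) ⊗ D y)         ∎)
    where
    exchange : P (suc y) ⊗ (oneₛ ⊟ β y) ≋ P y ⊗ (oneₛ ⊟ α y)
    exchange = SR.trans (SR.*-congˡ (SR.reflexive (≡.sym (factor-atLeast-≥ {y} ℕ.≤-refl))))
      (SR.trans (Π<-exchange (factor (atLeast (suc y)) 0) (factor (atLeast y) 0) y
                  (λ m m≢y → SR.reflexive (factor-atLeast-≢ m≢y)) (suc r) (s≤s y≤r))
                (SR.*-congˡ (SR.reflexive (factor-atLeast-< {suc y} (ℕ.n<1+n y)))))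

    pull : ∀ p g d → (p ⊗ g) ⊗ d ≋ g ⊗ (p ⊗ d)
    pull = solve 3 (λ p g d → (p :* g) :* d := g :* (p :* d)) SR.refl

  ΣαD ΣαZ ΣβD : Ser
  ΣαD = Σ< (suc r) (λ y → α y ⊗ D (suc y))
  ΣαZ = Σ< (suc r) (λ y → α y ⊗ Z (suc y))
  ΣβD = Σ< (suc r) (λ y → β y ⊗ D y)

  E≋1+ΣαD-ΣαZ : E ≋ oneₛ ⊕ (ΣαD ⊟ ΣαZ)
  E≋1+ΣαD-ΣαZ = begin
    E
      ≈⟨ E-first-letter ⟩
    oneₛ ⊕ U ⊗ sumₛ (map closing letters)
      ≈⟨ SR.+-congˡ (SR.*-congˡ (sumₛ-upTo closing (suc r))) ⟩
    oneₛ ⊕ U ⊗ Σ< (suc r) closing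
      ≈⟨ SR.+-congˡ (*-distribˡ-Σ< (suc r) U closing) ⟩
    oneₛ ⊕ Σ< (suc r) (λ y → U ⊗ closing y)
      ≈⟨ SR.+-congˡ (Σ<-cong (suc r) λ y →
           SR.trans (SR.*-congˡ (SR.*-congˡ (SR.+-congʳ (G-unbounded (atLeast (suc y)) 0))))
                    (distribute U (Q y) (D (suc y)) (Z (suc y)))) ⟩
    oneₛ ⊕ Σ< (suc r) (λ y → α y ⊗ D (suc y) ⊟ α y ⊗ Z (suc y))
      ≈⟨ SR.+-congˡ (Σ<-⊟ (suc r) _ _) ⟩
    oneₛ ⊕ (ΣαD ⊟ ΣαZ)
      ∎
    where
    distribute : ∀ u q d z → u ⊗ (q ⊗ (d ⊟ z)) ≋ (u ⊗ q) ⊗ d ⊟ (u ⊗ q) ⊗ z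
    distribute = solve 4 (λ u q d z → u :* (q :* (d :- z)) := (u :* q) :* d :- (u :* q) :* z) SR.refl

  ΣαZ≋Z-E : ΣαZ ≋ Z (suc r) ⊟ E
  ΣαZ≋Z-E = begin
    ΣαZ                                   ≈⟨ Σ<-cong-< (suc r) (λ y y<1+r → SR.trans (peel (α y) (Z (suc y)))
                                               (SR.+-congˡ (SR.-‿cong (Z-step y (ℕ.≤-pred y<1+r))))) ⟩
    Σ< (suc r) (λ y → Z (suc y) ⊟ Z y)    ≈⟨ Σ<-telescope Z (suc r) ⟩
    Z (suc r) ⊟ Z 0                       ≈⟨ SR.+-congˡ (SR.-‿cong (G-bound-zero (atLeast 0) 0)) ⟩
    Z (suc r) ⊟ E                         ∎
    where
    peel : ∀ a z → a ⊗ z ≋ z ⊟ (oneₛ ⊟ a) ⊗ z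
    peel = solve 2 (λ a z → a :* z := z :- (con (ℤ.+ 1) :- a) :* z) SR.refl

  ΣαD-ΣβD≋Z-D₀ : ΣαD ⊟ ΣβD ≋ Z (suc r) ⊟ D 0
  ΣαD-ΣβD≋Z-D₀ = begin
    ΣαD ⊟ ΣβD                                                  ≈⟨ Σ<-⊟ (suc r) _ _ ⟨
    Σ< (suc r) (λ y → α y ⊗ D (suc y) ⊟ β y ⊗ D y)             ≈⟨ Σ<-cong-< (suc r) (λ y y<1+r → step y (ℕ.≤-pred y<1+r)) ⟩
    Σ< (suc r) (λ y → D (suc y) ⊟ D y)                         ≈⟨ Σ<-telescope D (suc r) ⟩
    Z (suc r) ⊟ D 0                                            ∎
    where
    regroup : ∀ a b d₁ d₀ → a ⊗ d₁ ⊟ b ⊗ d₀ ≋ (d₁ ⊟ d₀) ⊕ ((oneₛ ⊟ b) ⊗ d₀ ⊟ (oneₛ ⊟ a) ⊗ d₁)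
    regroup = solve 4 (λ a b d₁ d₀ → a :* d₁ :- b :* d₀ :=
                                     (d₁ :- d₀) :+ ((con (ℤ.+ 1) :- b) :* d₀ :- (con (ℤ.+ 1) :- a) :* d₁)) SR.refl

    step : ∀ y → y ≤ r → α y ⊗ D (suc y) ⊟ β y ⊗ D y ≋ D (suc y) ⊟ D y
    step y y≤r = SR.trans (regroup (α y) (β y) (D (suc y)) (D y))
      (SR.trans (SR.+-congˡ (SR.trans (SR.+-congʳ (SR.sym (D-step y y≤r))) (SR.-‿inverseʳ _))) (SR.+-identityʳ _))

  ΣβD-shift : ΣβD ≋ β 0 ⊗ D 0 ⊕ SQ ⊗ (ΣαD ⊟ α r ⊗ Z (suc r))
  ΣβD-shift = begin
    ΣβD
      ≈⟨ Σ<-suc r (λ y → β y ⊗ D y) ⟩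
    β 0 ⊗ D 0 ⊕ Σ< r (λ y → β (suc y) ⊗ D (suc y))
      ≈⟨ SR.+-congˡ (Σ<-cong r λ y → SR.trans (SR.*-congʳ (SR.sym (SQ-α y))) (SR.*-assoc _ _ _)) ⟩
    β 0 ⊗ D 0 ⊕ Σ< r (λ y → SQ ⊗ (α y ⊗ D (suc y)))
      ≈⟨ SR.+-congˡ (*-distribˡ-Σ< r SQ _) ⟨
    β 0 ⊗ D 0 ⊕ SQ ⊗ Σ< r (λ y → α y ⊗ D (suc y))
      ≈⟨ SR.+-congˡ (SR.*-congˡ (drop-last (Σ< r (λ y → α y ⊗ D (suc y))) (α r ⊗ Z (suc r)))) ⟩
    β 0 ⊗ D 0 ⊕ SQ ⊗ (ΣαD ⊟ α r ⊗ Z (suc r))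
      ∎
    where
    SQ-α : ∀ y → SQ ⊗ α y ≋ β (suc y)
    SQ-α y = SR.trans (SR.*-congˡ (mono-⊗-mono 1 0 0 0 0 0 y 0))
      (SR.trans (mono-⊗-mono 0 1 1 0 1 0 y 0) (SR.sym (mono-⊗-mono 1 0 0 0 0 1 (suc y) 0)))

    drop-last : ∀ s t → s ≋ (s ⊕ t) ⊟ t
    drop-last = solve 2 (λ s t → s := (s :+ t) :- t) SR.refl

  ΣαD≋Z-1 : ΣαD ≋ Z (suc r) ⊟ oneₛ
  ΣαD≋Z-1 = begin
    ΣαD                                     ≈⟨ isolate ΣαD ΣαZ ⟩
    ((oneₛ ⊕ (ΣαD ⊟ ΣαZ)) ⊟ oneₛ) ⊕ ΣαZ     ≈⟨ SR.+-cong (SR.+-congʳ (SR.sym E≋1+ΣαD-ΣαZ)) ΣαZ≋Z-E ⟩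
    (E ⊟ oneₛ) ⊕ (Z (suc r) ⊟ E)            ≈⟨ collapse E (Z (suc r)) ⟩
    Z (suc r) ⊟ oneₛ                        ∎
    where
    isolate : ∀ d z → d ≋ ((oneₛ ⊕ (d ⊟ z)) ⊟ oneₛ) ⊕ z
    isolate = solve 2 (λ d z → d := ((con (ℤ.+ 1) :+ (d :- z)) :- con (ℤ.+ 1)) :+ z) SR.refl

    collapse : ∀ e z → (e ⊟ oneₛ) ⊕ (z ⊟ e) ≋ z ⊟ oneₛ
    collapse = solve 2 (λ e z → (e :- con (ℤ.+ 1)) :+ (z :- e) := z :- con (ℤ.+ 1)) SR.refl

  D₀-relation : D 0 ⊟ oneₛ ≋ β 0 ⊗ D 0 ⊕ SQ ⊗ ((Z (suc r) ⊟ oneₛ) ⊟ α r ⊗ Z (suc r))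
  D₀-relation = begin
    D 0 ⊟ oneₛ                                         ≈⟨ rewrite-as (D 0) (Z (suc r)) ⟩
    (Z (suc r) ⊟ oneₛ) ⊟ (Z (suc r) ⊟ D 0)             ≈⟨ SR.+-cong (SR.sym ΣαD≋Z-1) (SR.-‿cong (SR.sym ΣαD-ΣβD≋Z-D₀)) ⟩
    ΣαD ⊟ (ΣαD ⊟ ΣβD)                                  ≈⟨ cancel ΣαD ΣβD ⟩
    ΣβD                                                ≈⟨ ΣβD-shift ⟩
    β 0 ⊗ D 0 ⊕ SQ ⊗ (ΣαD ⊟ α r ⊗ Z (suc r))           ≈⟨ SR.+-congˡ (SR.*-congˡ (SR.+-congʳ ΣαD≋Z-1)) ⟩
    β 0 ⊗ D 0 ⊕ SQ ⊗ ((Z (suc r) ⊟ oneₛ) ⊟ α r ⊗ Z (suc r)) ∎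
    where
    rewrite-as : ∀ d z → d ⊟ oneₛ ≋ (z ⊟ oneₛ) ⊟ (z ⊟ d)
    rewrite-as = solve 2 (λ d z → d :- con (ℤ.+ 1) := (z :- con (ℤ.+ 1)) :- (z :- d)) SR.refl

    cancel : ∀ a b → a ⊟ (a ⊟ b) ≋ b
    cancel = solve 2 (λ a b → a :- (a :- b) := b) SR.refl

  D₀-Z-identity : (oneₛ ⊟ β 0) ⊗ D 0 ⊟ SQ ⊗ ((oneₛ ⊟ α r) ⊗ Z (suc r)) ≋ oneₛ ⊟ SQ
  D₀-Z-identity = begin
    (oneₛ ⊟ β 0) ⊗ D 0 ⊟ SQ ⊗ ((oneₛ ⊟ α r) ⊗ Z (suc r))
      ≈⟨ expand (β 0) (D 0) SQ (α r) (Z (suc r)) ⟩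
    (oneₛ ⊟ SQ) ⊕ ((D 0 ⊟ oneₛ) ⊟ (β 0 ⊗ D 0 ⊕ SQ ⊗ ((Z (suc r) ⊟ oneₛ) ⊟ α r ⊗ Z (suc r))))
      ≈⟨ SR.+-congˡ (SR.trans (SR.+-congʳ D₀-relation) (SR.-‿inverseʳ _)) ⟩
    (oneₛ ⊟ SQ) ⊕ zeroₛ
      ≈⟨ SR.+-identityʳ _ ⟩
    oneₛ ⊟ SQ
      ∎
    where
    expand : ∀ b₀ d₀ sq aᵣ z → (oneₛ ⊟ b₀) ⊗ d₀ ⊟ sq ⊗ ((oneₛ ⊟ aᵣ) ⊗ z) ≋
                               (oneₛ ⊟ sq) ⊕ ((d₀ ⊟ oneₛ) ⊟ (b₀ ⊗ d₀ ⊕ sq ⊗ ((z ⊟ oneₛ) ⊟ aᵣ ⊗ z)))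
    expand = solve 5 (λ b₀ d₀ sq aᵣ z → (con (ℤ.+ 1) :- b₀) :* d₀ :- sq :* ((con (ℤ.+ 1) :- aᵣ) :* z) :=
      (con (ℤ.+ 1) :- sq) :+ ((d₀ :- con (ℤ.+ 1)) :- (b₀ :* d₀ :+ sq :* ((z :- con (ℤ.+ 1)) :- aᵣ :* z)))) SR.refl

  E-identity : (pochhammer U r ⊟ SQ ⊗ pochhammer USQ r) ⊗ E ≋ ((oneₛ ⊟ SQ) ⊗ pochhammer U r) ⊗ pochhammer USQ r
  E-identity = begin
    (a ⊟ SQ ⊗ b) ⊗ E
      ≈⟨ distribute a SQ b E ⟩
    a ⊗ E ⊟ (SQ ⊗ b) ⊗ E
      ≈⟨ SR.+-cong (SR.*-congˡ E≋P₀D₀) (SR.-‿cong (SR.*-congˡ (SR.sym (pochhammer-Z (suc r) ℕ.≤-refl)))) ⟩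
    a ⊗ ((b ⊗ (oneₛ ⊟ β 0)) ⊗ D 0) ⊟ (SQ ⊗ b) ⊗ ((a ⊗ (oneₛ ⊟ α r)) ⊗ Z (suc r))
      ≈⟨ factor-ab a b (β 0) (D 0) SQ (α r) (Z (suc r)) ⟩
    (a ⊗ b) ⊗ ((oneₛ ⊟ β 0) ⊗ D 0 ⊟ SQ ⊗ ((oneₛ ⊟ α r) ⊗ Z (suc r)))
      ≈⟨ SR.*-congˡ D₀-Z-identity ⟩
    (a ⊗ b) ⊗ (oneₛ ⊟ SQ)
      ≈⟨ reorder a b SQ ⟩
    ((oneₛ ⊟ SQ) ⊗ a) ⊗ b
      ∎
    where
    a b : Ser
    a = pochhammer U r
    b = pochhammer USQ r

    E≋P₀D₀ : E ≋ (b ⊗ (oneₛ ⊟ β 0)) ⊗ D 0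
    E≋P₀D₀ = SR.sym (SR.trans (SR.*-congʳ P₀≋) (Π<-factor-G (atLeast 0) 0 (suc r) ℕ.≤-refl))
      where
      USQ-Q : ∀ m → USQ ⊗ Q m ≋ β (suc m)
      USQ-Q m = SR.trans (mono-⊗-mono 1 1 1 0 0 0 m 0) (SR.sym (mono-⊗-mono 1 0 0 0 0 1 (suc m) 0))

      P₀≋ : b ⊗ (oneₛ ⊟ β 0) ≋ P 0
      P₀≋ = begin
        b ⊗ (oneₛ ⊟ β 0)                              ≈⟨ SR.*-comm _ _ ⟩
        (oneₛ ⊟ β 0) ⊗ b                              ≈⟨ SR.*-congˡ (Π<-cong-< r λ m _ → SR.+-congˡ (SR.-‿cong (USQ-Q m))) ⟩
        (oneₛ ⊟ β 0) ⊗ Π< r (λ m → oneₛ ⊟ β (suc m))  ≈⟨ SR.sym (SR.*-congʳ (SR.reflexive (factor-atLeast-≥ {0} {0} z≤n))) ⟩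
        factor (atLeast 0) 0 0 ⊗ Π< r (λ m → factor (atLeast 0) 0 (suc m)) ≈⟨ Π<-suc r (factor (atLeast 0) 0) ⟨
        P 0                                           ∎

    distribute : ∀ a q b e → (a ⊟ q ⊗ b) ⊗ e ≋ a ⊗ e ⊟ (q ⊗ b) ⊗ e
    distribute = solve 4 (λ a q b e → (a :- q :* b) :* e := a :* e :- (q :* b) :* e) SR.refl

    factor-ab : ∀ a b b₀ d₀ sq aᵣ z →
      a ⊗ ((b ⊗ (oneₛ ⊟ b₀)) ⊗ d₀) ⊟ (sq ⊗ b) ⊗ ((a ⊗ (oneₛ ⊟ aᵣ)) ⊗ z) ≋
      (a ⊗ b) ⊗ ((oneₛ ⊟ b₀) ⊗ d₀ ⊟ sq ⊗ ((oneₛ ⊟ aᵣ) ⊗ z))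
    factor-ab = solve 7 (λ a b b₀ d₀ sq aᵣ z →
      a :* ((b :* (con (ℤ.+ 1) :- b₀)) :* d₀) :- (sq :* b) :* ((a :* (con (ℤ.+ 1) :- aᵣ)) :* z) :=
      (a :* b) :* ((con (ℤ.+ 1) :- b₀) :* d₀ :- sq :* ((con (ℤ.+ 1) :- aᵣ) :* z))) SR.refl

    reorder : ∀ a b q → (a ⊗ b) ⊗ (oneₛ ⊟ q) ≋ ((oneₛ ⊟ q) ⊗ a) ⊗ b
    reorder = solve 3 (λ a b q → (a :* b) :* (con (ℤ.+ 1) :- q) := ((con (ℤ.+ 1) :- q) :* a) :* b) SR.refl

W : ℕ → Ser
W r = GeneratingSeries.G r (λ _ → false) 1 nothing

module _ where
  open ≡ using (refl; cong)
  open ≡.≡-Reasoning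
  open import Data.List.Relation.Unary.All as All using (All; []; _∷_)
  import Data.List.Relation.Unary.All.Properties as All

  weight-coefficient : ∀ w b c d →
    weight (λ _ → false) 1 nothing w (length w) b c d ≡ ℤ.+ countFact b c d w
  weight-coefficient w b c d = begin
    weight (λ _ → false) 1 nothing w (length w) b c d
      ≡⟨ cong (λ f → f (length w) b c d) (unbounded (factorization w)) ⟩
    mono (length w) (L ℕ.+ count (λ _ → false) (prefix w)) (tot w) (1 ℕ.* k) (length w) b c d
      ≡⟨ mono-at-degree (length w) (L ℕ.+ count (λ _ → false) (prefix w)) (tot w) (1 ℕ.* k) b c d ⟩
    (if (L ℕ.+ count (λ _ → false) (prefix w) ≡ᵇ b) ∧ (tot w ≡ᵇ c) ∧ (1 ℕ.* k ≡ᵇ d) then 1ℤ else 0ℤ)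
      ≡⟨ ≡.cong₂ (λ L′ k′ → if (L′ ≡ᵇ b) ∧ (tot w ≡ᵇ c) ∧ (k′ ≡ᵇ d) then 1ℤ else 0ℤ)
           (≡.trans (cong (L ℕ.+_) (count-false (prefix w))) (ℕ.+-identityʳ L)) (ℕ.*-identityˡ k) ⟩
    (if (L ≡ᵇ b) ∧ (tot w ≡ᵇ c) ∧ (k ≡ᵇ d) then 1ℤ else 0ℤ)
      ≡⟨ if-indicator ((L ≡ᵇ b) ∧ (tot w ≡ᵇ c) ∧ (k ≡ᵇ d)) ⟩
    ℤ.+ indicator ((L ≡ᵇ b) ∧ (tot w ≡ᵇ c) ∧ (k ≡ᵇ d))
      ≡⟨ cong ℤ.+_ (countFact≡indicator b c d w) ⟨
    ℤ.+ countFact b c d w ∎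
    where
    L k : ℕ
    L = wlecF (factorization w)
    k = length (prefix w)

    unbounded : ∀ F → weightᶠ (λ _ → false) 1 nothing (length w) (tot w) F ≡
                      mono (length w) (wlecF F ℕ.+ count (λ _ → false) (proj₁ F)) (tot w) (1 ℕ.* length (proj₁ F))
    unbounded ([]    , hs) = refl
    unbounded (_ ∷ _ , hs) = refl

    ≡ᵇ-refl : ∀ n → (n ≡ᵇ n) ≡ true
    ≡ᵇ-refl zero    = refl
    ≡ᵇ-refl (suc n) = ≡ᵇ-refl n

    mono-at-degree : ∀ n L t k b c d → mono n L t k n b c d ≡ (if (L ≡ᵇ b) ∧ (t ≡ᵇ c) ∧ (k ≡ᵇ d) then 1ℤ else 0ℤ)
    mono-at-degree n L t k b c d rewrite ≡ᵇ-refl n = refl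

    count-false : ∀ v → count (λ _ → false) v ≡ 0
    count-false []      = refl
    count-false (_ ∷ v) = count-false v

    if-indicator : ∀ X → (if X then 1ℤ else 0ℤ) ≡ ℤ.+ indicator X
    if-indicator true  = refl
    if-indicator false = refl

  module _ (r : ℕ) where

    words-length : ∀ n → All (λ w → length w ≡ n) (words r n)
    words-length zero    = refl ∷ []
    words-length (suc n) = All.concat⁺ (All.map⁺ (All.applyUpTo⁺₂ (λ x → x) (suc r)
                             λ _ → All.map⁺ (All.map (cong suc) (words-length n))))

    WordSer≋W : WordSer r ≋ W r
    WordSer≋W = mk≋ λ n b c d → ≡.sym (sum-coefficient n b c d (words r n) (words-length n))
      where
      sum-coefficient : ∀ n b c d ws → All (λ w → length w ≡ n) ws →
        sumₛ (map (weight (λ _ → false) 1 nothing) ws) n b c d ≡ ℤ.+ sum (map (countFact b c d) ws)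
      sum-coefficient n b c d []       []           = refl
      sum-coefficient n b c d (w ∷ ws) (refl ∷ ls) =
        ≡.trans (⊕-coefficient (weight (λ _ → false) 1 nothing w) _ n b c d)
        (≡.trans (≡.cong₂ ℤ._+_ (weight-coefficient w b c d) (sum-coefficient n b c d ws ls))
        (≡.sym (ℤ.pos-+ (countFact b c d w) _)))

module _ where
  open import Relation.Binary.Reasoning.Setoid SR.setoid

  *ₛ≋⊗ : ∀ f g → f *ₛ g ≋ f ⊗ g
  *ₛ≋⊗ f g = mk≋ λ a b c d → ≡.sym (⊗-coefficient f g a b c d)

  poch≋pochhammer : ∀ x n → poch x n ≋ pochhammer x n
  poch≋pochhammer x zero    = SR.refl
  poch≋pochhammer x (suc n) =
    SR.trans (*ₛ-cong (poch≋pochhammer x n) (SR.trans (-ₛ≋⊕⊖ oneₛ _) (SR.+-congˡ (SR.-‿cong (*ₛ≋⊗ x (Q n))))))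
             (*ₛ≋⊗ _ _)

  Num≋pochhammers : ∀ r → Num r ≋ ((oneₛ ⊟ SQ) ⊗ pochhammer U r) ⊗ pochhammer USQ r
  Num≋pochhammers r = SR.trans (*ₛ-cong (SR.trans (*ₛ-cong (-ₛ≋⊕⊖ oneₛ SQ) (poch≋pochhammer U r)) (*ₛ≋⊗ _ _))
                              (poch≋pochhammer USQ r))
                    (*ₛ≋⊗ _ _)

  Den≋pochhammers : ∀ r → Den r ≋ (pochhammer U r ⊟ SQ ⊗ pochhammer USQ r) ⊗ pochhammer UY (suc r)
  Den≋pochhammers r = SR.trans (*ₛ-cong (SR.trans (-ₛ≋⊕⊖ (poch U r) _)
                                (SR.+-cong (poch≋pochhammer U r)
                                           (SR.-‿cong (SR.trans (*ₛ-cong (SR.refl {SQ}) (poch≋pochhammer USQ r)) (*ₛ≋⊗ _ _)))))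
                              (poch≋pochhammer UY (suc r)))
                    (*ₛ≋⊗ _ _)

  module _ (r : ℕ) where
    open GeneratingSeries r

    pochhammer-UY-W : pochhammer UY (suc r) ⊗ W r ≋ E
    pochhammer-UY-W = begin
      pochhammer UY (suc r) ⊗ W r
        ≈⟨ SR.*-cong (Π<-cong-< (suc r) λ m _ → SR.+-congˡ (SR.-‿cong (UY-Q m))) (G-unbounded (λ _ → false) 1) ⟩
      Π< (suc r) (factor (λ _ → false) 1) ⊗ G (λ _ → false) 1 (just (suc r))
        ≈⟨ Π<-factor-G (λ _ → false) 1 (suc r) ℕ.≤-refl ⟩
      E ∎
      where
      UY-Q : ∀ m → UY ⊗ Q m ≋ U ⊗ mono 0 0 m 1
      UY-Q m = SR.trans (mono-⊗-mono 1 0 0 1 0 0 m 0) (SR.sym (mono-⊗-mono 1 0 0 0 0 0 m 1))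

    Den⊗W≋Num : Den r ⊗ W r ≋ Num r
    Den⊗W≋Num = begin
      Den r ⊗ W r                                                  ≈⟨ SR.*-congʳ (Den≋pochhammers r) ⟩
      ((a ⊟ SQ ⊗ b) ⊗ pochhammer UY (suc r)) ⊗ W r                 ≈⟨ SR.*-assoc _ _ _ ⟩
      (a ⊟ SQ ⊗ b) ⊗ (pochhammer UY (suc r) ⊗ W r)                 ≈⟨ SR.*-congˡ pochhammer-UY-W ⟩
      (a ⊟ SQ ⊗ b) ⊗ E                                             ≈⟨ IdentityForE.E-identity r ⟩
      ((oneₛ ⊟ SQ) ⊗ a) ⊗ b                                        ≈⟨ Num≋pochhammers r ⟨
      Num r                                                        ∎
      where
      a b : Ser
      a = pochhammer U r
      b = pochhammer USQ r

corollary2p4 : (r : ℕ) → (Den r *ₛ WordSer r) ≈ₛ Num r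
corollary2p4 r = get (begin
  Den r *ₛ WordSer r   ≈⟨ *ₛ≋⊗ (Den r) (WordSer r) ⟩
  Den r ⊗ WordSer r    ≈⟨ SR.*-congˡ (WordSer≋W r) ⟩
  Den r ⊗ W r          ≈⟨ Den⊗W≋Num r ⟩
  Num r                ∎)
  where open import Relation.Binary.Reasoning.Setoid SR.setoid
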